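{- Let $q$ be an odd prime power with $q \equiv 1 \pmod 4$, and let $A$ be an integer such that $q+1-A \equiv 0 \pmod 8$ (so that $q+1+A \equiv 4 \pmod 8$). Then $N_{n2}(A) = N_{n2}(-A) = N(-A)$.
   Context: For $d \in \mathbb{F}_q\setminus\{0,1\}$, $L_d$ denotes the Legendre elliptic curve $y^2 = x(x-1)(x-d)$ over $\mathbb{F}_q$, and $A(d,\mathbb{F}_q) = q+1-\#L_d(\mathbb{F}_q) = -\sum_{x\in\mathbb{F}_q}\chi_2(x(x-1)(x-d))$, where $\chi_2$ is the quadratic character of $\mathbb{F}_q$. For an integer $A$, $N(A)$ is the number of $d \in \mathbb{F}_q\setminus\{0,1\}$ with $A(d,\mathbb{F}_q)=A$, and $N_{n2}(A)$ is the number of such $d$ that are non-squares in $\mathbb{F}_q$. -}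

module Defs where

open import Level using (0ℓ)
open import Data.Nat as ℕ using (ℕ; _^_; _≤_)
open import Data.Nat.Primality using (Prime)
open import Data.Integer as ℤ using (ℤ; +_; -_; _+_)
open import Data.Fin using (Fin)
open import Data.List using (List; map; allFin; filter; length; foldr)
open import Data.List.Relation.Unary.Any using (any?)
open import Data.Product using (Σ; ∃; _×_; _,_)
open import Relation.Nullary using (¬_; Dec; yes; no; ¬?)
open import Relation.Nullary.Decidable using (_×-dec_)
open import Relation.Binary.PropositionalEquality using (_≡_; _≢_)
open import Relation.Binary using (DecidableEquality)
open import Algebra.Structures using (IsCommutativeRing)
open import Function.Bundles using (_↔_; Inverse)

IsPrimePower : ℕ → Set
IsPrimePower q = Σ ℕ λ p → Σ ℕ λ k → Prime p × 1 ≤ k × q ≡ p ^ k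

record FiniteField (q : ℕ) : Set₁ where
  infixl 7 _*_
  infixl 6 _+F_
  field
    Carrier : Set
    _+F_    : Carrier → Carrier → Carrier
    _*_     : Carrier → Carrier → Carrier
    -F_     : Carrier → Carrier
    0F 1F   : Carrier
    isCommutativeRing : IsCommutativeRing _≡_ _+F_ _*_ -F_ 0F 1F
    0≢1     : 0F ≢ 1F
    inverse : ∀ x → x ≢ 0F → Σ Carrier λ y → x * y ≡ 1F
    _≟_     : DecidableEquality Carrier
    enum    : Carrier ↔ Fin q

  _-F_ : Carrier → Carrier → Carrier
  x -F y = x +F (-F y)

  elements : List Carrier
  elements = map (Inverse.from enum) (allFin q)

  isSquare? : (x : Carrier) → Dec (Data.List.Relation.Unary.Any.Any (λ y → y * y ≡ x) elements)
  isSquare? x = any? (λ y → (y * y) ≟ x) elements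

  χ₂ : Carrier → ℤ
  χ₂ x with x ≟ 0F
  ... | yes _ = + 0
  ... | no _ with isSquare? x
  ...   | yes _ = + 1
  ...   | no _ = ℤ.-[1+ 0 ]

  sumℤ : List ℤ → ℤ
  sumℤ = foldr _+_ (+ 0)

  traceA : Carrier → ℤ
  traceA d = - sumℤ (map (λ x → χ₂ (x * (x -F 1F) * (x -F d))) elements)

  Counted? : (A : ℤ) → (d : Carrier) → Dec (¬ (d ≡ 0F) × ¬ (d ≡ 1F) × traceA d ≡ A)
  Counted? A d = ¬? (d ≟ 0F) ×-dec ¬? (d ≟ 1F) ×-dec (traceA d ℤ.≟ A)

  N : ℤ → ℕ
  N A = length (filter (Counted? A) elements)

  Nn2 : ℤ → ℕ
  Nn2 A = length (filter (λ d → Counted? A d ×-dec ¬? (isSquare? d)) elements)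

module Submission where

-- First equality: for a nonsquare d the substitution x = y/d gives
-- x(x-1)(x-1/d) = d · d⁻⁴ · y(y-1)(y-d), and χ₂(d) = -1, so A(1/d) = -A(d);
-- thus d ↦ 1/d matches the nonsquares counted by N_n2(A) with those counted
-- by N_n2(-A).
-- Second equality: no square d ∉ {0, 1} has A(d) = -A. For such d the point
-- count is q + 1 - A(d) = 4 + 2|X|, where X is the set of x with
-- f(x) = x(x-1)(x-d) a nonzero square. Translation by the 2-torsion points
-- (0,0) and (1,0) acts on X by σ(x) = d/x and τ(x) = (x-d)/(x-1), a Klein
-- four-group, and counting orbits gives |X| ≡ |Fix σ| + |Fix τ| + |Fix στ|
-- (mod 4). Here |Fix σ| = 2 (the roots ±√d) and Fix τ, Fix στ are the
-- solution sets of (x-1)² = 1-d and (x-d)² = d²-d, which correspond under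
-- an affine map (using √-1) and have even size, so |X| ≡ 2 (mod 4) and
-- 8 ∣ q + 1 - A(d). This contradicts 8 ∣ q + 1 - A when A(d) = -A.

open import Level using (0ℓ)
open import Function using (_∘_)
open import Data.Nat as ℕ using (ℕ; zero; suc; _%_)
import Data.Nat.Properties as ℕP
open import Data.Nat.Tactic.RingSolver using (solve-∀)
open import Data.Integer as ℤ using (ℤ; +_; -_; _-_; -[1+_])
import Data.Integer.Properties as ℤP
open import Data.Integer.Tactic.RingSolver using () renaming (solve-∀ to ℤ-solve-∀)
open import Data.Integer.Divisibility using (_∣_)
import Data.Nat.Divisibility as ND
import Data.Integer.Divisibility.Signed as DS
import Data.Nat.DivMod as DivMod
open import Data.Sign as Sign using (Sign)
open import Data.Fin as Fin using (Fin)
import Data.Fin.Properties as FinP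
open import Data.List as List using (List; []; _∷_)
open import Data.Vec.Functional as Vec using (Vector)
open import Data.List.Relation.Unary.Any as Any using (Any)
open import Data.List.Membership.Propositional using (_∈_; lose)
open import Data.List.Membership.Propositional.Properties using (∈-map⁺; ∈-allFin)
open import Data.Maybe using (Maybe; just; nothing)
open import Data.Product using (Σ; _×_; _,_; proj₁; proj₂)
open import Data.Sum using (_⊎_; inj₁; inj₂)
open import Data.Empty using (⊥; ⊥-elim)
open import Data.Unit using (tt)
open import Relation.Nullary using (Dec; yes; no; ¬_; ¬?)
open import Relation.Nullary.Decidable using (_×-dec_; _⊎-dec_; toWitnessFalse)
open import Relation.Binary.PropositionalEquality
open import Function.Bundles using (Inverse)
open import Data.Fin.Permutation using (Permutation; permutation)
open import Algebra.Properties.Monoid.Sum ℕP.+-0-monoid using () renaming (sum to sumℕ; sum-cong-≗ to sumℕ-cong)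
open import Algebra.Structures using (IsCommutativeMonoid)
open import Algebra.Bundles using (CommutativeRing; CommutativeMonoid)
import Algebra.Solver.Ring.AlmostCommutativeRing as ACR
open import Defs

𝟙[_] : ∀ {P : Set} → Dec P → ℕ
𝟙[ yes _ ] = 1
𝟙[ no _ ]  = 0

𝟙-yes : ∀ {P : Set} (p? : Dec P) → P → 𝟙[ p? ] ≡ 1
𝟙-yes (yes _) _ = refl
𝟙-yes (no ¬p) p = ⊥-elim (¬p p)

𝟙-no : ∀ {P : Set} (p? : Dec P) → ¬ P → 𝟙[ p? ] ≡ 0
𝟙-no (yes p) ¬p = ⊥-elim (¬p p)
𝟙-no (no _)  _  = refl

𝟙-⇔ : ∀ {P Q : Set} (p? : Dec P) (q? : Dec Q) → (P → Q) → (Q → P) → 𝟙[ p? ] ≡ 𝟙[ q? ]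
𝟙-⇔ (yes _) (yes _) _ _ = refl
𝟙-⇔ (yes p) (no ¬q) f _ = ⊥-elim (¬q (f p))
𝟙-⇔ (no ¬p) (yes q) _ g = ⊥-elim (¬p (g q))
𝟙-⇔ (no _)  (no _)  _ _ = refl

𝟙-⊎ : ∀ {P Q : Set} (p? : Dec P) (q? : Dec Q) → ¬ (P × Q) → 𝟙[ p? ⊎-dec q? ] ≡ 𝟙[ p? ] ℕ.+ 𝟙[ q? ]
𝟙-⊎ (yes p) (yes q) disjoint = ⊥-elim (disjoint (p , q))
𝟙-⊎ (yes _) (no _)  _        = refl
𝟙-⊎ (no _)  (yes _) _        = refl
𝟙-⊎ (no _)  (no _)  _        = refl

length-filter≡count : ∀ {A : Set} {P : A → Set} (P? : ∀ x → Dec (P x)) (xs : List A) →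
  List.length (List.filter P? xs) ≡ List.foldr ℕ._+_ 0 (List.map (λ x → 𝟙[ P? x ]) xs)
length-filter≡count P? []       = refl
length-filter≡count P? (x ∷ xs) with P? x
... | yes _ = cong suc (length-filter≡count P? xs)
... | no _  = length-filter≡count P? xs

foldr-homo : ∀ {C D : Set} {_⊕_ : C → C → C} {_⊗_ : D → D → D} {ε : C} {ε′ : D} (h : C → D) →
  h ε ≡ ε′ → (∀ a b → h (a ⊕ b) ≡ h a ⊗ h b) →
  ∀ {n} (v : Vector C n) → Vec.foldr _⊗_ ε′ (h ∘ v) ≡ h (Vec.foldr _⊕_ ε v)
foldr-homo h h-ε h-⊕ {zero}  v = sym h-ε
foldr-homo {_⊗_ = _⊗_} h h-ε h-⊕ {suc n} v =
  trans (cong (h (v Fin.zero) ⊗_) (foldr-homo h h-ε h-⊕ (v ∘ Fin.suc))) (sym (h-⊕ _ _))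

sum-ones : ∀ n → sumℕ {n} (λ _ → 1) ≡ n
sum-ones zero    = refl
sum-ones (suc n) = cong suc (sum-ones n)

sum-zeros : ∀ n → sumℕ {n} (λ _ → 0) ≡ 0
sum-zeros zero    = refl
sum-zeros (suc n) = sum-zeros n

sum-delta : ∀ {n} (j : Fin n) → sumℕ (λ i → 𝟙[ i Fin.≟ j ]) ≡ 1
sum-delta {suc n} Fin.zero    = cong suc (sum-zeros n)
sum-delta {suc n} (Fin.suc j) =
  trans (sumℕ-cong (λ i → 𝟙-⇔ (Fin.suc i Fin.≟ Fin.suc j) (i Fin.≟ j) FinP.suc-injective (cong Fin.suc)))
        (sum-delta j)

sum≡0⇒zero : ∀ {n} (v : Vector ℕ n) → sumℕ v ≡ 0 → ∀ i → v i ≡ 0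
sum≡0⇒zero v eq Fin.zero    = ℕP.m+n≡0⇒m≡0 (v Fin.zero) eq
sum≡0⇒zero v eq (Fin.suc i) = sum≡0⇒zero (v ∘ Fin.suc) (ℕP.m+n≡0⇒n≡0 (v Fin.zero) eq) i

even≢odd : ∀ a b → a ℕ.+ a ≢ suc (b ℕ.+ b)
even≢odd zero    b       ()
even≢odd (suc a) zero    e = ℕP.1+n≢0 (trans (sym (ℕP.+-suc a a)) (ℕP.suc-injective e))
even≢odd (suc a) (suc b) e = even≢odd a b (ℕP.suc-injective
  (trans (sym (ℕP.+-suc a a)) (trans (ℕP.suc-injective e) (cong suc (ℕP.+-suc b b)))))

double-injective : ∀ a b → a ℕ.+ a ≡ b ℕ.+ b → a ≡ b
double-injective zero    zero    e = refl
double-injective (suc a) (suc b) e = cong suc (double-injective a b (ℕP.suc-injective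
  (trans (sym (ℕP.+-suc a a)) (trans (ℕP.suc-injective e) (ℕP.+-suc b b)))))

%4≡1⇒4t+1 : ∀ q → q % 4 ≡ 1 → q ≡ suc (((q ℕ./ 4) ℕ.+ (q ℕ./ 4)) ℕ.+ ((q ℕ./ 4) ℕ.+ (q ℕ./ 4)))
%4≡1⇒4t+1 q q%4≡1 = trans (DivMod.m≡m%n+[m/n]*n q 4) (cong₂ ℕ._+_ q%4≡1 (times4 (q ℕ./ 4)))
  where
  times4 : ∀ t → t ℕ.* 4 ≡ (t ℕ.+ t) ℕ.+ (t ℕ.+ t)
  times4 = solve-∀

-- For q = 4t + 1, the integers q + 1 - A and q + 1 + A are not both
-- divisible by 8, as their sum 2(q + 1) = 8t + 4 is not.
not-both-divisible-by-8 : ∀ q t (A : ℤ) → q ≡ suc ((t ℕ.+ t) ℕ.+ (t ℕ.+ t)) →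
                          (+ 8) ∣ (+ suc q - A) → (+ 8) ∣ (+ suc q - (- A)) → ⊥
not-both-divisible-by-8 q t A refl 8∣q+1-A 8∣q+1+A = 8∤4 (ND.∣m+n∣m⇒∣n 8∣8t+4 (ND.n∣m*n t))
  where
  8∤4 : ¬ (8 ND.∣ 4)
  8∤4 = toWitnessFalse {a? = 8 ND.∣? 4} tt
  sum : (+ suc q - A) ℤ.+ (+ suc q - (- A)) ≡ + (t ℕ.* 8 ℕ.+ 4)
  sum = trans (ℤ-identity (+ suc q) A) (cong +_ (ℕ-identity t))
    where
    ℤ-identity : ∀ a A → (a - A) ℤ.+ (a - (- A)) ≡ a ℤ.+ a
    ℤ-identity = ℤ-solve-∀
    ℕ-identity : ∀ t → suc (suc ((t ℕ.+ t) ℕ.+ (t ℕ.+ t))) ℕ.+ suc (suc ((t ℕ.+ t) ℕ.+ (t ℕ.+ t))) ≡ t ℕ.* 8 ℕ.+ 4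
    ℕ-identity = solve-∀
  8∣8t+4 : 8 ND.∣ t ℕ.* 8 ℕ.+ 4
  8∣8t+4 = subst ((+ 8) ∣_) sum (DS.∣⇒∣ᵤ (DS.∣m∣n⇒∣m+n (DS.∣ᵤ⇒∣ {+ 8} {+ suc q - A} 8∣q+1-A)
                                                      (DS.∣ᵤ⇒∣ {+ 8} {+ suc q - (- A)} 8∣q+1+A)))

module _ {q : ℕ} (F : FiniteField q) where
  open FiniteField F

  CR : CommutativeRing 0ℓ 0ℓ
  CR = record { isCommutativeRing = isCommutativeRing }

  open CommutativeRing CR using (+-comm; +-assoc; +-identityˡ; +-identityʳ; -‿inverseʳ; ring; semiring)
  open import Algebra.Properties.Ring ring using (-‿involutive; -‿distribˡ-*; -‿distribʳ-*; -‿+-comm; -0#≈0#)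
  open import Algebra.Properties.Semiring.Mult.TCOptimised semiring using (1+×; ×-homo-+; ×1-homo-*) renaming (_×_ to _×ℕ_)

  -- The canonical ring map ℤ → F; its homomorphism laws let the ring solver
  -- work over F with integer coefficients.
  ιℕ : ℕ → Carrier
  ιℕ n = n ×ℕ 1F

  ι : ℤ → Carrier
  ι (+ n)    = ιℕ n
  ι -[1+ n ] = -F ιℕ (suc n)

  signed : Sign → Carrier → Carrier
  signed Sign.+ x = x
  signed Sign.- x = -F x

  signed-* : ∀ s t x y → signed (s Sign.* t) (x * y) ≡ signed s x * signed t y
  signed-* Sign.+ Sign.+ x y = refl
  signed-* Sign.+ Sign.- x y = -‿distribʳ-* x y
  signed-* Sign.- Sign.+ x y = -‿distribˡ-* x y
  signed-* Sign.- Sign.- x y =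
    trans (sym (-‿involutive _)) (trans (cong -F_ (-‿distribʳ-* x y)) (-‿distribˡ-* x (-F y)))

  ι-◃ : ∀ s n → ι (s ℤ.◃ n) ≡ signed s (ιℕ n)
  ι-◃ Sign.+ zero    = refl
  ι-◃ Sign.- zero    = sym -0#≈0#
  ι-◃ Sign.+ (suc n) = refl
  ι-◃ Sign.- (suc n) = refl

  ι-signAbs : ∀ i → ι i ≡ signed (ℤ.sign i) (ιℕ ℤ.∣ i ∣)
  ι-signAbs (+ n)    = refl
  ι-signAbs -[1+ n ] = refl

  ι-* : ∀ i j → ι (i ℤ.* j) ≡ ι i * ι j
  ι-* i j = begin
    ι (i ℤ.* j)                                         ≡⟨ ι-◃ (ℤ.sign i Sign.* ℤ.sign j) (ℤ.∣ i ∣ ℕ.* ℤ.∣ j ∣) ⟩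
    signed (ℤ.sign i Sign.* ℤ.sign j) (ιℕ (ℤ.∣ i ∣ ℕ.* ℤ.∣ j ∣)) ≡⟨ cong (signed (ℤ.sign i Sign.* ℤ.sign j)) (×1-homo-* ℤ.∣ i ∣ ℤ.∣ j ∣) ⟩
    signed (ℤ.sign i Sign.* ℤ.sign j) (ιℕ ℤ.∣ i ∣ * ιℕ ℤ.∣ j ∣) ≡⟨ signed-* (ℤ.sign i) (ℤ.sign j) _ _ ⟩
    signed (ℤ.sign i) (ιℕ ℤ.∣ i ∣) * signed (ℤ.sign j) (ιℕ ℤ.∣ j ∣) ≡⟨ sym (cong₂ _*_ (ι-signAbs i) (ι-signAbs j)) ⟩
    ι i * ι j                                           ∎
    where open ≡-Reasoning

  ι-⊖ : ∀ m n → ι (m ℤ.⊖ n) ≡ ιℕ m -F ιℕ n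
  ι-⊖ zero    zero    = sym (trans (cong (0F +F_) -0#≈0#) (+-identityʳ 0F))
  ι-⊖ zero    (suc n) = sym (+-identityˡ _)
  ι-⊖ (suc m) zero    = sym (trans (cong (ιℕ (suc m) +F_) -0#≈0#) (+-identityʳ _))
  ι-⊖ (suc m) (suc n) = begin
    ι (suc m ℤ.⊖ suc n)               ≡⟨ cong ι (ℤP.[1+m]⊖[1+n]≡m⊖n m n) ⟩
    ι (m ℤ.⊖ n)                        ≡⟨ ι-⊖ m n ⟩
    ιℕ m -F ιℕ n                       ≡⟨ sym (cancel-1 (ιℕ m) (ιℕ n)) ⟩
    (1F +F ιℕ m) -F (1F +F ιℕ n)       ≡⟨ sym (cong₂ _-F_ (1+× m 1F) (1+× n 1F)) ⟩
    ιℕ (suc m) -F ιℕ (suc n)           ∎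
    where
    open ≡-Reasoning
    cancel-1 : ∀ a b → (1F +F a) -F (1F +F b) ≡ a -F b
    cancel-1 a b = begin
      (1F +F a) +F -F (1F +F b)    ≡⟨ cong ((1F +F a) +F_) (sym (-‿+-comm 1F b)) ⟩
      (1F +F a) +F (-F 1F +F -F b) ≡⟨ +-assoc 1F a _ ⟩
      1F +F (a +F (-F 1F +F -F b)) ≡⟨ cong (1F +F_) (trans (sym (+-assoc a _ _)) (trans (cong (_+F -F b) (+-comm a _)) (+-assoc _ a _))) ⟩
      1F +F (-F 1F +F (a -F b))    ≡⟨ sym (+-assoc 1F _ _) ⟩
      (1F -F 1F) +F (a -F b)       ≡⟨ cong (_+F (a -F b)) (-‿inverseʳ 1F) ⟩
      0F +F (a -F b)               ≡⟨ +-identityˡ _ ⟩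
      a -F b                       ∎

  ι-+ : ∀ i j → ι (i ℤ.+ j) ≡ ι i +F ι j
  ι-+ -[1+ m ] -[1+ n ] = begin
    -F ιℕ (suc (suc (m ℕ.+ n)))     ≡⟨ cong (λ k → -F ιℕ (suc k)) (sym (ℕP.+-suc m n)) ⟩
    -F ιℕ (suc m ℕ.+ suc n)         ≡⟨ cong -F_ (×-homo-+ 1F (suc m) (suc n)) ⟩
    -F (ιℕ (suc m) +F ιℕ (suc n))   ≡⟨ sym (-‿+-comm _ _) ⟩
    ι -[1+ m ] +F ι -[1+ n ]        ∎
    where open ≡-Reasoning
  ι-+ -[1+ m ] (+ n)    = trans (ι-⊖ n (suc m)) (+-comm _ _)
  ι-+ (+ m)    -[1+ n ] = ι-⊖ m (suc n)
  ι-+ (+ m)    (+ n)    = ×-homo-+ 1F m n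

  ι-neg : ∀ i → ι (ℤ.- i) ≡ -F ι i
  ι-neg -[1+ n ]     = sym (-‿involutive _)
  ι-neg (+ zero)     = sym -0#≈0#
  ι-neg (+ (suc n))  = refl

  ι-morphism : ℤ.+-*-rawRing ACR.-Raw-AlmostCommutative⟶ ACR.fromCommutativeRing CR
  ι-morphism = record
    { ⟦_⟧ = ι ; +-homo = ι-+ ; *-homo = ι-* ; -‿homo = ι-neg ; 0-homo = refl ; 1-homo = refl }

  ι-equal? : ∀ a b → Maybe (ι a ≡ ι b)
  ι-equal? a b with a ℤ.≟ b
  ... | yes refl = just refl
  ... | no _     = nothing

  open import Algebra.Solver.Ring ℤ.+-*-rawRing (ACR.fromCommutativeRing CR) ι-morphism ι-equal?
    using (solve; _:=_; _:+_; _:*_; _:-_; :-_; con; Polynomial)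

  :0 :1 : ∀ {n} → Polynomial n
  :0 = con (+ 0)
  :1 = con (+ 1)

  fromFin : Fin q → Carrier
  fromFin = Inverse.from enum

  toFin : Carrier → Fin q
  toFin = Inverse.to enum

  fromFin-toFin : ∀ x → fromFin (toFin x) ≡ x
  fromFin-toFin = Inverse.strictlyInverseʳ enum

  toFin-fromFin : ∀ i → toFin (fromFin i) ≡ i
  toFin-fromFin = Inverse.strictlyInverseˡ enum

  module FieldSum {C : Set} {_⊕_ : C → C → C} {ε : C} (isCM : IsCommutativeMonoid _≡_ _⊕_ ε) where
    private
      M : CommutativeMonoid 0ℓ 0ℓ
      M = record { isCommutativeMonoid = isCM }
    open import Algebra.Properties.CommutativeMonoid.Sum M using (sum; sum-cong-≗; ∑-distrib-+; ∑-comm; sum-permute)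

    ∑ : (Carrier → C) → C
    ∑ g = sum (g ∘ fromFin)

    ∑-elements : ∀ g → List.foldr _⊕_ ε (List.map g elements) ≡ ∑ g
    ∑-elements g = go (λ i → i)
      where
      go : ∀ {n} (f : Fin n → Fin q) → List.foldr _⊕_ ε (List.map g (List.map fromFin (List.tabulate f))) ≡ sum (g ∘ fromFin ∘ f)
      go {zero}  f = refl
      go {suc n} f = cong (g (fromFin (f Fin.zero)) ⊕_) (go (f ∘ Fin.suc))

    ∑-cong : ∀ {g h} → (∀ x → g x ≡ h x) → ∑ g ≡ ∑ h
    ∑-cong eq = sum-cong-≗ (eq ∘ fromFin)

    ∑-+ : ∀ g h → ∑ (λ x → g x ⊕ h x) ≡ ∑ g ⊕ ∑ h
    ∑-+ g h = ∑-distrib-+ (g ∘ fromFin) (h ∘ fromFin)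

    ∑-swap : ∀ (h : Carrier → Carrier → C) → ∑ (λ x → ∑ (h x)) ≡ ∑ (λ y → ∑ (λ x → h x y))
    ∑-swap h = ∑-comm (λ i j → h (fromFin i) (fromFin j))

    ∑-reindex : ∀ (π π⁻¹ : Carrier → Carrier) → (∀ x → π (π⁻¹ x) ≡ x) → (∀ x → π⁻¹ (π x) ≡ x) →
                ∀ g → ∑ (g ∘ π) ≡ ∑ g
    ∑-reindex π π⁻¹ ππ⁻¹ π⁻¹π g =
      sym (trans (sum-permute (g ∘ fromFin) p) (sum-cong-≗ (λ i → cong g (fromFin-toFin (π (fromFin i))))))
      where
      conj : (Carrier → Carrier) → Fin q → Fin q
      conj ρ = toFin ∘ ρ ∘ fromFin
      conj-inverse : ∀ (ρ ρ′ : Carrier → Carrier) → (∀ x → ρ (ρ′ x) ≡ x) → ∀ i → conj ρ (conj ρ′ i) ≡ i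
      conj-inverse ρ ρ′ ρρ′≡id i = trans (cong (toFin ∘ ρ) (fromFin-toFin _)) (trans (cong toFin (ρρ′≡id _)) (toFin-fromFin i))
      p : Permutation q q
      p = permutation (conj π) (conj π⁻¹) (conj-inverse π π⁻¹ ππ⁻¹) (conj-inverse π⁻¹ π π⁻¹π)

  module ∑ℕ = FieldSum ℕP.+-0-isCommutativeMonoid
  module ∑ℤ = FieldSum ℤP.+-0-isCommutativeMonoid
  open ∑ℕ using (∑; ∑-cong; ∑-+)

  count : ∀ {P : Carrier → Set} → (∀ x → Dec (P x)) → ℕ
  count P? = ∑ (λ x → 𝟙[ P? x ])

  count-filter : ∀ {P : Carrier → Set} (P? : ∀ x → Dec (P x)) → List.length (List.filter P? elements) ≡ count P?
  count-filter P? = trans (length-filter≡count P? elements) (∑ℕ.∑-elements _)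

  ∑-ones : ∑ (λ _ → 1) ≡ q
  ∑-ones = sum-ones q

  count-≡ : ∀ a → count (_≟ a) ≡ 1
  count-≡ a = trans (sumℕ-cong (λ i → 𝟙-⇔ (fromFin i ≟ a) (i Fin.≟ toFin a) fwd bwd)) (sum-delta (toFin a))
    where
    fwd : ∀ {i} → fromFin i ≡ a → i ≡ toFin a
    fwd {i} e = trans (sym (toFin-fromFin i)) (cong toFin e)
    bwd : ∀ {i} → i ≡ toFin a → fromFin i ≡ a
    bwd e = trans (cong fromFin e) (fromFin-toFin a)

  count-pair : ∀ a b → a ≢ b → count (λ x → (x ≟ a) ⊎-dec (x ≟ b)) ≡ 2
  count-pair a b a≢b =
    trans (∑-cong (λ x → 𝟙-⊎ (x ≟ a) (x ≟ b) (λ (x≡a , x≡b) → a≢b (trans (sym x≡a) x≡b))))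
          (trans (∑-+ (λ x → 𝟙[ x ≟ a ]) (λ x → 𝟙[ x ≟ b ])) (cong₂ ℕ._+_ (count-≡ a) (count-≡ b)))

  count-∅ : ∀ {P : Carrier → Set} (P? : ∀ x → Dec (P x)) → (∀ x → ¬ P x) → count P? ≡ 0
  count-∅ P? none = trans (∑-cong (λ x → 𝟙-no (P? x) (none x))) (sum-zeros q)

  count≡0 : ∀ {P : Carrier → Set} (P? : ∀ x → Dec (P x)) → count P? ≡ 0 → ∀ x → ¬ P x
  count≡0 P? eq x p = ℕP.1+n≢0 (trans (sym (𝟙-yes (P? x) p)) (trans (cong (λ y → 𝟙[ P? y ]) (sym (fromFin-toFin x)))
                                   (sum≡0⇒zero (λ i → 𝟙[ P? (fromFin i) ]) eq (toFin x))))

  count-complement : ∀ {P : Carrier → Set} (P? : ∀ x → Dec (P x)) → count P? ℕ.+ count (¬? ∘ P?) ≡ q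
  count-complement P? = trans (sym (∑-+ (λ x → 𝟙[ P? x ]) (λ x → 𝟙[ ¬? (P? x) ]))) (trans (∑-cong one) ∑-ones)
    where
    one : ∀ x → 𝟙[ P? x ] ℕ.+ 𝟙[ ¬? (P? x) ] ≡ 1
    one x with P? x
    ... | yes _ = refl
    ... | no _  = refl

  ∑ℤ-neg : ∀ g → ∑ℤ.∑ (λ x → - g x) ≡ - ∑ℤ.∑ g
  ∑ℤ-neg g = foldr-homo -_ refl ℤP.neg-distrib-+ (g ∘ fromFin)

  ∑ℤ-pos : ∀ g → ∑ℤ.∑ (λ x → + g x) ≡ + ∑ g
  ∑ℤ-pos g = foldr-homo +_ refl ℤP.pos-+ (g ∘ fromFin)

  open ≡-Reasoning

  1≢0 : 1F ≢ 0F
  1≢0 e = 0≢1 (sym e)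

  0*x : ∀ x → 0F * x ≡ 0F
  0*x = solve 1 (λ x → :0 :* x := :0) refl

  difference≡0 : ∀ {a b} → a -F b ≡ 0F → a ≡ b
  difference≡0 {a} {b} e = begin
    a              ≡⟨ solve 2 (λ a b → a := (a :- b) :+ b) refl a b ⟩
    (a -F b) +F b  ≡⟨ cong (_+F b) e ⟩
    0F +F b        ≡⟨ solve 1 (λ b → :0 :+ b := b) refl b ⟩
    b              ∎

  difference≢0 : ∀ {a b} → a ≢ b → a -F b ≢ 0F
  difference≢0 a≢b = a≢b ∘ difference≡0

  -- The multiplicative inverse, extended by inv 0 = 0.
  inv : Carrier → Carrier
  inv x with x ≟ 0F
  ... | yes _  = 0F
  ... | no x≢0 = proj₁ (inverse x x≢0)

  x*inv-x : ∀ x → x ≢ 0F → x * inv x ≡ 1F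
  x*inv-x x x≢0 with x ≟ 0F
  ... | yes x≡0 = ⊥-elim (x≢0 x≡0)
  ... | no x≢0′ = proj₂ (inverse x x≢0′)

  inv-x*x : ∀ x → x ≢ 0F → inv x * x ≡ 1F
  inv-x*x x x≢0 = trans (solve 2 (λ a b → a :* b := b :* a) refl (inv x) x) (x*inv-x x x≢0)

  inv-0 : inv 0F ≡ 0F
  inv-0 with 0F ≟ 0F
  ... | yes _ = refl
  ... | no 0≢0 = ⊥-elim (0≢0 refl)

  *-cancelˡ : ∀ {a b c} → a ≢ 0F → a * b ≡ a * c → b ≡ c
  *-cancelˡ {a} {b} {c} a≢0 e = begin
    b                ≡⟨ solve 1 (λ b → b := :1 :* b) refl b ⟩
    1F * b           ≡⟨ cong (_* b) (sym (inv-x*x a a≢0)) ⟩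
    inv a * a * b    ≡⟨ solve 3 (λ x y z → x :* y :* z := x :* (y :* z)) refl (inv a) a b ⟩
    inv a * (a * b)  ≡⟨ cong (inv a *_) e ⟩
    inv a * (a * c)  ≡⟨ solve 3 (λ x y z → x :* (y :* z) := x :* y :* z) refl (inv a) a c ⟩
    inv a * a * c    ≡⟨ cong (_* c) (inv-x*x a a≢0) ⟩
    1F * c           ≡⟨ solve 1 (λ c → :1 :* c := c) refl c ⟩
    c                ∎

  zero-divisor : ∀ a b → a * b ≡ 0F → a ≡ 0F ⊎ b ≡ 0F
  zero-divisor a b ab≡0 with a ≟ 0F
  ... | yes a≡0 = inj₁ a≡0
  ... | no a≢0  = inj₂ (*-cancelˡ a≢0 (trans ab≡0 (solve 1 (λ a → :0 := a :* :0) refl a)))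

  *-nonzero : ∀ {a b} → a ≢ 0F → b ≢ 0F → a * b ≢ 0F
  *-nonzero a≢0 b≢0 ab≡0 with zero-divisor _ _ ab≡0
  ... | inj₁ a≡0 = a≢0 a≡0
  ... | inj₂ b≡0 = b≢0 b≡0

  square-nonzero : ∀ {a} → a ≢ 0F → a * a ≢ 0F
  square-nonzero a≢0 = *-nonzero a≢0 a≢0

  inv-unique : ∀ x y → x * y ≡ 1F → inv x ≡ y
  inv-unique x y xy≡1 = *-cancelˡ x≢0 (trans (x*inv-x x x≢0) (sym xy≡1))
    where
    x≢0 : x ≢ 0F
    x≢0 x≡0 = 1≢0 (trans (sym xy≡1) (trans (cong (_* y) x≡0) (0*x y)))

  inv-nonzero : ∀ x → x ≢ 0F → inv x ≢ 0F
  inv-nonzero x x≢0 inv≡0 = 1≢0 (trans (sym (x*inv-x x x≢0)) (trans (cong (x *_) inv≡0) (solve 1 (λ a → a :* :0 := :0) refl x)))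

  inv-involutive : ∀ x → inv (inv x) ≡ x
  inv-involutive x = by-cases (x ≟ 0F)
    where
    by-cases : Dec (x ≡ 0F) → inv (inv x) ≡ x
    by-cases (yes x≡0) = trans (cong (inv ∘ inv) x≡0) (trans (cong inv inv-0) (trans inv-0 (sym x≡0)))
    by-cases (no x≢0)  = inv-unique (inv x) x (inv-x*x x x≢0)

  inv-1 : inv 1F ≡ 1F
  inv-1 = inv-unique 1F 1F (solve 0 (:1 :* :1 := :1) refl)

  clear-denominator : ∀ {a b c} → b ≢ 0F → a * inv b ≡ c → a ≡ c * b
  clear-denominator {a} {b} {c} b≢0 e = begin
    a                  ≡⟨ solve 1 (λ z → z := z :* :1) refl a ⟩
    a * 1F             ≡⟨ cong (a *_) (sym (inv-x*x b b≢0)) ⟩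
    a * (inv b * b)    ≡⟨ solve 3 (λ a i b → a :* (i :* b) := (a :* i) :* b) refl a (inv b) b ⟩
    a * inv b * b      ≡⟨ cong (_* b) e ⟩
    c * b              ∎

  fractions-equal : ∀ {a b c g} → b ≢ 0F → g ≢ 0F → a * g ≡ c * b → a * inv b ≡ c * inv g
  fractions-equal {a} {b} {c} {g} b≢0 g≢0 e = begin
    a * inv b                  ≡⟨ solve 1 (λ z → z := z :* :1) refl (a * inv b) ⟩
    a * inv b * 1F             ≡⟨ cong (a * inv b *_) (sym (x*inv-x g g≢0)) ⟩
    a * inv b * (g * inv g)    ≡⟨ solve 4 (λ a ib g ig → a :* ib :* (g :* ig) := (a :* g) :* ib :* ig) refl a (inv b) g (inv g) ⟩
    (a * g) * inv b * inv g    ≡⟨ cong (λ z → z * inv b * inv g) e ⟩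
    (c * b) * inv b * inv g    ≡⟨ solve 4 (λ c b ib ig → (c :* b) :* ib :* ig := c :* ig :* (b :* ib)) refl c b (inv b) (inv g) ⟩
    c * inv g * (b * inv b)    ≡⟨ cong (c * inv g *_) (x*inv-x b b≢0) ⟩
    c * inv g * 1F             ≡⟨ solve 1 (λ z → z :* :1 := z) refl (c * inv g) ⟩
    c * inv g                  ∎

  fractions-equal⁻¹ : ∀ {a b c g} → b ≢ 0F → g ≢ 0F → a * inv b ≡ c * inv g → a * g ≡ c * b
  fractions-equal⁻¹ {a} {b} {c} {g} b≢0 g≢0 e = begin
    a * g                  ≡⟨ cong (_* g) (clear-denominator b≢0 e) ⟩
    c * inv g * b * g      ≡⟨ solve 4 (λ c ig b g → c :* ig :* b :* g := c :* b :* (g :* ig)) refl c (inv g) b g ⟩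
    c * b * (g * inv g)    ≡⟨ cong (c * b *_) (x*inv-x g g≢0) ⟩
    c * b * 1F             ≡⟨ solve 2 (λ c b → c :* b :* :1 := c :* b) refl c b ⟩
    c * b                  ∎

  square-roots : ∀ x y → x * x ≡ y * y → x ≡ y ⊎ x ≡ -F y
  square-roots x y e with zero-divisor (x -F y) (x +F y) difference-of-squares
    where
    difference-of-squares : (x -F y) * (x +F y) ≡ 0F
    difference-of-squares = begin
      (x -F y) * (x +F y)    ≡⟨ solve 2 (λ x y → (x :- y) :* (x :+ y) := x :* x :- y :* y) refl x y ⟩
      (x * x) -F (y * y)     ≡⟨ cong (_-F (y * y)) e ⟩
      (y * y) -F (y * y)     ≡⟨ solve 1 (λ y → y :* y :- y :* y := :0) refl y ⟩
      0F                     ∎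
  ... | inj₁ x-y≡0 = inj₁ (difference≡0 x-y≡0)
  ... | inj₂ x+y≡0 = inj₂ (difference≡0 (trans (solve 2 (λ x y → x :- (:- y) := x :+ y) refl x y) x+y≡0))

  IsSquare : Carrier → Set
  IsSquare x = Any (λ y → y * y ≡ x) elements

  square : ∀ y x → y * y ≡ x → IsSquare x
  square y x e = lose y∈elements e
    where
    y∈elements : y ∈ elements
    y∈elements = subst (_∈ elements) (fromFin-toFin y) (∈-map⁺ fromFin (∈-allFin (toFin y)))

  square-root : ∀ {x} → IsSquare x → Σ Carrier (λ y → y * y ≡ x)
  square-root = Any.satisfied

  IsSquare-0 : IsSquare 0F
  IsSquare-0 = square 0F 0F (0*x 0F)

  IsSquare-1 : IsSquare 1F
  IsSquare-1 = square 1F 1F (solve 0 (:1 :* :1 := :1) refl)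

  IsSquare-* : ∀ {a b} → IsSquare a → IsSquare b → IsSquare (a * b)
  IsSquare-* sa sb with square-root sa | square-root sb
  ... | u , u²≡a | v , v²≡b =
    square (u * v) _ (trans (solve 2 (λ u v → (u :* v) :* (u :* v) := (u :* u) :* (v :* v)) refl u v) (cong₂ _*_ u²≡a v²≡b))

  IsSquare-divide : ∀ u g → u ≢ 0F → IsSquare (u * u * g) → IsSquare g
  IsSquare-divide u g u≢0 s with square-root s
  ... | w , w²≡u²g = square (w * inv u) g (begin
    w * inv u * (w * inv u)          ≡⟨ solve 2 (λ w i → w :* i :* (w :* i) := w :* w :* (i :* i)) refl w (inv u) ⟩
    w * w * (inv u * inv u)          ≡⟨ cong (_* (inv u * inv u)) w²≡u²g ⟩
    u * u * g * (inv u * inv u)      ≡⟨ solve 3 (λ u g i → u :* u :* g :* (i :* i) := (u :* i) :* (u :* i) :* g) refl u g (inv u) ⟩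
    (u * inv u) * (u * inv u) * g    ≡⟨ cong (λ z → z * z * g) (x*inv-x u u≢0) ⟩
    1F * 1F * g                      ≡⟨ solve 1 (λ g → :1 :* :1 :* g := g) refl g ⟩
    g                                ∎)

  χ₂-zero : ∀ x → x ≡ 0F → χ₂ x ≡ + 0
  χ₂-zero x x≡0 with x ≟ 0F
  ... | yes _  = refl
  ... | no x≢0 = ⊥-elim (x≢0 x≡0)

  χ₂-square : ∀ x → x ≢ 0F → IsSquare x → χ₂ x ≡ + 1
  χ₂-square x x≢0 s with x ≟ 0F
  ... | yes x≡0 = ⊥-elim (x≢0 x≡0)
  ... | no _ with isSquare? x
  ...   | yes _  = refl
  ...   | no ¬s  = ⊥-elim (¬s s)

  χ₂-nonsquare : ∀ x → ¬ IsSquare x → χ₂ x ≡ -[1+ 0 ]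
  χ₂-nonsquare x ¬s with x ≟ 0F
  ... | yes x≡0 = ⊥-elim (¬s (subst IsSquare (sym x≡0) IsSquare-0))
  ... | no _ with isSquare? x
  ...   | yes s = ⊥-elim (¬s s)
  ...   | no _  = refl

  IsSquare-inv : ∀ {y} → IsSquare y → IsSquare (inv y)
  IsSquare-inv {y} s with square-root s
  ... | w , w²≡y = square (inv w) (inv y) (trans (sym (inv-square (w ≟ 0F))) (cong inv w²≡y))
    where
    inv-square : Dec (w ≡ 0F) → inv (w * w) ≡ inv w * inv w
    inv-square (yes w≡0) = begin
      inv (w * w)        ≡⟨ cong (λ z → inv (z * z)) w≡0 ⟩
      inv (0F * 0F)      ≡⟨ cong inv (0*x 0F) ⟩
      inv 0F             ≡⟨ inv-0 ⟩
      0F                 ≡⟨ sym (0*x 0F) ⟩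
      0F * 0F            ≡⟨ cong (λ z → z * z) (trans (sym inv-0) (cong inv (sym w≡0))) ⟩
      inv w * inv w      ∎
    inv-square (no w≢0) = inv-unique (w * w) (inv w * inv w) (begin
      w * w * (inv w * inv w)        ≡⟨ solve 2 (λ w i → w :* w :* (i :* i) := (w :* i) :* (w :* i)) refl w (inv w) ⟩
      (w * inv w) * (w * inv w)      ≡⟨ cong (λ z → z * z) (x*inv-x w w≢0) ⟩
      1F * 1F                        ≡⟨ solve 0 (:1 :* :1 := :1) refl ⟩
      1F                             ∎)

  nonsquare-nonzero : ∀ {c} → ¬ IsSquare c → c ≢ 0F
  nonsquare-nonzero ¬s c≡0 = ¬s (subst IsSquare (sym c≡0) IsSquare-0)

  nonsquare-*-square : ∀ c x → ¬ IsSquare c → x ≢ 0F → IsSquare x → ¬ IsSquare (c * x)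
  nonsquare-*-square c x ¬sc x≢0 sx scx with square-root sx
  ... | t , t²≡x = ¬sc (IsSquare-divide t c t≢0 (subst IsSquare (trans (cong (c *_) (sym t²≡x)) (solve 2 (λ c t → c :* (t :* t) := t :* t :* c) refl c t)) scx))
    where
    t≢0 : t ≢ 0F
    t≢0 t≡0 = x≢0 (trans (sym t²≡x) (trans (cong (λ z → z * z) t≡0) (0*x 0F)))

  χ₂-square-factor : ∀ u → u ≢ 0F → ∀ g → χ₂ (u * u * g) ≡ χ₂ g
  χ₂-square-factor u u≢0 g = by-cases (g ≟ 0F) (isSquare? g)
    where
    by-cases : Dec (g ≡ 0F) → Dec (IsSquare g) → χ₂ (u * u * g) ≡ χ₂ g
    by-cases (yes g≡0) _ = trans (χ₂-zero (u * u * g) (trans (cong (u * u *_) g≡0) (solve 1 (λ u → u :* u :* :0 := :0) refl u))) (sym (χ₂-zero g g≡0))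
    by-cases (no g≢0) (yes sg) = trans (χ₂-square (u * u * g) (*-nonzero (square-nonzero u≢0) g≢0) (IsSquare-* (square u (u * u) refl) sg)) (sym (χ₂-square g g≢0 sg))
    by-cases (no _) (no ¬sg)   = trans (χ₂-nonsquare (u * u * g) (¬sg ∘ IsSquare-divide u g u≢0)) (sym (χ₂-nonsquare g ¬sg))


  -- Position of an element in the enumeration; used to pick a canonical
  -- member of each 2-cycle of an involution.
  idx : Carrier → ℕ
  idx x = Fin.toℕ (toFin x)

  idx-injective : ∀ {x y} → idx x ≡ idx y → x ≡ y
  idx-injective {x} {y} e = trans (sym (fromFin-toFin x)) (trans (cong fromFin (FinP.toℕ-injective e)) (fromFin-toFin y))

  -- Counting with an involution π of a decidable subset P of F: the
  -- elements of P are the fixed points plus two copies of the lower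
  -- members of the 2-cycles.
  module Involution {P : Carrier → Set} (P? : ∀ x → Dec (P x)) (π : Carrier → Carrier)
                    (π-closed : ∀ x → P x → P (π x)) (π-involutive : ∀ x → P x → π (π x) ≡ x) where

    Fixed? : ∀ x → Dec (P x × π x ≡ x)
    Fixed? x = P? x ×-dec (π x ≟ x)

    Lower? : ∀ x → Dec (P x × idx x ℕ.< idx (π x))
    Lower? x = P? x ×-dec (idx x ℕ.<? idx (π x))

    private
      Upper? : ∀ x → Dec (P x × idx (π x) ℕ.< idx x)
      Upper? x = P? x ×-dec (idx (π x) ℕ.<? idx x)

      trichotomy : ∀ x → 𝟙[ P? x ] ≡ 𝟙[ Fixed? x ] ℕ.+ (𝟙[ Lower? x ] ℕ.+ 𝟙[ Upper? x ])
      trichotomy x with P? x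
      ... | no _  = refl
      ... | yes _ with π x ≟ x | idx x ℕ.<? idx (π x) | idx (π x) ℕ.<? idx x
      ...   | yes e  | yes l | _      = ⊥-elim (ℕP.<-irrefl (cong idx (sym e)) l)
      ...   | yes e  | no _  | yes l  = ⊥-elim (ℕP.<-irrefl (cong idx e) l)
      ...   | yes _  | no _  | no _   = refl
      ...   | no _   | yes l | yes l′ = ⊥-elim (ℕP.<-asym l l′)
      ...   | no _   | yes _ | no _   = refl
      ...   | no _   | no _  | yes _  = refl
      ...   | no πx≢x | no ¬l | no ¬l′ = ⊥-elim (πx≢x (idx-injective (ℕP.≤-antisym (ℕP.≮⇒≥ ¬l) (ℕP.≮⇒≥ ¬l′))))

      π̂ : Carrier → Carrier
      π̂ x with P? x
      ... | yes _ = π x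
      ... | no _  = x

      π̂-in : ∀ x → P x → π̂ x ≡ π x
      π̂-in x p with P? x
      ... | yes _ = refl
      ... | no ¬p = ⊥-elim (¬p p)

      π̂-out : ∀ x → ¬ P x → π̂ x ≡ x
      π̂-out x ¬p with P? x
      ... | yes p = ⊥-elim (¬p p)
      ... | no _  = refl

      π̂-involutive : ∀ x → π̂ (π̂ x) ≡ x
      π̂-involutive x with P? x
      ... | yes p = trans (π̂-in (π x) (π-closed x p)) (π-involutive x p)
      ... | no ¬p = π̂-out x ¬p

      upper≡lower∘π̂ : ∀ x → 𝟙[ Upper? x ] ≡ 𝟙[ Lower? (π̂ x) ]
      upper≡lower∘π̂ x = by-cases (P? x)
        where
        by-cases : Dec (P x) → 𝟙[ Upper? x ] ≡ 𝟙[ Lower? (π̂ x) ]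
        by-cases (no ¬p) = trans (𝟙-no (Upper? x) (¬p ∘ proj₁)) (sym (𝟙-no (Lower? (π̂ x)) (¬p ∘ subst P (π̂-out x ¬p) ∘ proj₁)))
        by-cases (yes p) = 𝟙-⇔ (Upper? x) (Lower? (π̂ x))
          (λ (_ , l) → subst P (sym (π̂-in x p)) (π-closed x p) ,
                       subst₂ (λ y z → idx y ℕ.< idx z) (sym (π̂-in x p)) (sym (trans (cong π (π̂-in x p)) (π-involutive x p))) l)
          (λ (_ , l) → p , subst₂ (λ y z → idx y ℕ.< idx z) (π̂-in x p) (trans (cong π (π̂-in x p)) (π-involutive x p)) l)

    parity : count P? ≡ count Fixed? ℕ.+ (count Lower? ℕ.+ count Lower?)
    parity = begin
      count P?                                                 ≡⟨ ∑-cong trichotomy ⟩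
      ∑ (λ x → 𝟙[ Fixed? x ] ℕ.+ (𝟙[ Lower? x ] ℕ.+ 𝟙[ Upper? x ])) ≡⟨ ∑-+ (λ x → 𝟙[ Fixed? x ]) (λ x → 𝟙[ Lower? x ] ℕ.+ 𝟙[ Upper? x ]) ⟩
      count Fixed? ℕ.+ ∑ (λ x → 𝟙[ Lower? x ] ℕ.+ 𝟙[ Upper? x ])     ≡⟨ cong (count Fixed? ℕ.+_) (∑-+ (λ x → 𝟙[ Lower? x ]) (λ x → 𝟙[ Upper? x ])) ⟩
      count Fixed? ℕ.+ (count Lower? ℕ.+ count Upper?)          ≡⟨ cong (λ u → count Fixed? ℕ.+ (count Lower? ℕ.+ u)) upper≡lower ⟩
      count Fixed? ℕ.+ (count Lower? ℕ.+ count Lower?)          ∎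
      where
      upper≡lower : count Upper? ≡ count Lower?
      upper≡lower = trans (∑-cong upper≡lower∘π̂) (∑ℕ.∑-reindex π̂ π̂ π̂-involutive π̂-involutive (λ x → 𝟙[ Lower? x ]))

    parity-free : (∀ x → P x → π x ≢ x) → count P? ≡ count Lower? ℕ.+ count Lower?
    parity-free free = trans parity (cong (ℕ._+ (count Lower? ℕ.+ count Lower?))
                                          (count-∅ Fixed? (λ x (p , e) → free x p e)))

  module KleinFourGroup {X : Carrier → Set} (X? : ∀ x → Dec (X x)) (σ τ : Carrier → Carrier)
     (σ-closed : ∀ x → X x → X (σ x)) (τ-closed : ∀ x → X x → X (τ x))
     (σ-involutive : ∀ x → X x → σ (σ x) ≡ x) (τ-involutive : ∀ x → X x → τ (τ x) ≡ x)
     (στ≡τσ : ∀ x → X x → σ (τ x) ≡ τ (σ x))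
     (no-common-fixed-point : ∀ x → X x → σ x ≡ x → τ x ≡ x → ⊥) where

    Fixed-σ? : ∀ x → Dec (X x × σ x ≡ x)
    Fixed-σ? x = X? x ×-dec (σ x ≟ x)

    Fixed-τ? : ∀ x → Dec (X x × τ x ≡ x)
    Fixed-τ? x = X? x ×-dec (τ x ≟ x)

    Fixed-στ? : ∀ x → Dec (X x × σ (τ x) ≡ x)
    Fixed-στ? x = X? x ×-dec (σ (τ x) ≟ x)

    private
      module Byσ = Involution X? σ σ-closed σ-involutive

      R : Carrier → Set
      R x = X x × idx x ℕ.< idx (σ x)

      R? : ∀ x → Dec (R x)
      R? = Byσ.Lower?

      σx≢x : ∀ x → R x → σ x ≢ x
      σx≢x x (_ , l) e = ℕP.<-irrefl (cong idx (sym e)) l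

      τστ≡σ : ∀ x → X x → τ (σ (τ x)) ≡ σ x
      τστ≡σ x x∈X = trans (sym (στ≡τσ (τ x) (τ-closed x x∈X))) (cong σ (τ-involutive x x∈X))

      choose : ∀ {A : Set} → Dec A → Carrier → Carrier → Carrier
      choose (yes _) a _ = a
      choose (no _)  _ b = b

      ρ : Carrier → Carrier
      ρ x = choose (idx (τ x) ℕ.<? idx (σ (τ x))) (τ x) (σ (τ x))

      data ρ-Cases (x : Carrier) : Set where
        τ-lower : idx (τ x) ℕ.< idx (σ (τ x)) → ρ x ≡ τ x → ρ-Cases x
        τ-upper : ¬ idx (τ x) ℕ.< idx (σ (τ x)) → ρ x ≡ σ (τ x) → ρ-Cases x

      ρ-cases : ∀ x → ρ-Cases x
      ρ-cases x = by-cases (idx (τ x) ℕ.<? idx (σ (τ x))) refl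
        where
        by-cases : (l? : Dec (idx (τ x) ℕ.< idx (σ (τ x)))) →
                   (choose l? (τ x) (σ (τ x)) ≡ ρ x) → ρ-Cases x
        by-cases (yes l) e = τ-lower l (sym e)
        by-cases (no ¬l) e = τ-upper ¬l (sym e)

      ρ-closed : ∀ x → R x → R (ρ x)
      ρ-closed x (x∈X , l) with ρ-cases x
      ... | τ-lower l′ e = subst R (sym e) (τ-closed x x∈X , l′)
      ... | τ-upper ¬l e = subst R (sym e) (σ-closed (τ x) τx∈X ,
              subst (λ z → idx (σ (τ x)) ℕ.< idx z) (sym (σ-involutive (τ x) τx∈X))
                (ℕP.≤∧≢⇒< (ℕP.≮⇒≥ ¬l) (λ ie → στx≢τx (idx-injective ie))))
        where
        τx∈X = τ-closed x x∈X
        στx≢τx : σ (τ x) ≢ τ x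
        στx≢τx e′ = σx≢x x (x∈X , l) (trans (sym (τστ≡σ x x∈X)) (trans (cong τ e′) (τ-involutive x x∈X)))

      ρ-involutive : ∀ x → R x → ρ (ρ x) ≡ x
      ρ-involutive x (x∈X , l) with ρ-cases x
      ... | τ-lower _ e = trans (cong ρ e) (back (ρ-cases (τ x)))
        where
        back : ρ-Cases (τ x) → ρ (τ x) ≡ x
        back (τ-lower _ e′) = trans e′ (τ-involutive x x∈X)
        back (τ-upper ¬l _) = ⊥-elim (¬l (subst₂ (λ a b → idx a ℕ.< idx b) (sym (τ-involutive x x∈X)) (sym (cong σ (τ-involutive x x∈X))) l))
      ... | τ-upper _ e = trans (cong ρ e) (back (ρ-cases (σ (τ x))))
        where
        back : ρ-Cases (σ (τ x)) → ρ (σ (τ x)) ≡ x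
        back (τ-lower l′ _) = ⊥-elim (ℕP.<-asym l (subst₂ (λ a b → idx a ℕ.< idx b) (τστ≡σ x x∈X)
                                                       (trans (cong σ (τστ≡σ x x∈X)) (σ-involutive x x∈X)) l′))
        back (τ-upper _ e′) = trans e′ (trans (cong σ (τστ≡σ x x∈X)) (σ-involutive x x∈X))

      module Byρ = Involution R? ρ ρ-closed ρ-involutive

      R∩Fixed-τ? : ∀ x → Dec (R x × τ x ≡ x)
      R∩Fixed-τ? x = R? x ×-dec (τ x ≟ x)

      R∩Fixed-στ? : ∀ x → Dec (R x × σ (τ x) ≡ x)
      R∩Fixed-στ? x = R? x ×-dec (σ (τ x) ≟ x)

      Fixed-ρ-split : ∀ x → 𝟙[ Byρ.Fixed? x ] ≡ 𝟙[ R∩Fixed-τ? x ] ℕ.+ 𝟙[ R∩Fixed-στ? x ]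
      Fixed-ρ-split x = trans (𝟙-⇔ (Byρ.Fixed? x) (R∩Fixed-τ? x ⊎-dec R∩Fixed-στ? x) fwd bwd)
                              (𝟙-⊎ (R∩Fixed-τ? x) (R∩Fixed-στ? x) disjoint)
        where
        disjoint : ¬ ((R x × τ x ≡ x) × (R x × σ (τ x) ≡ x))
        disjoint ((r , e₁) , (_ , e₂)) = σx≢x x r (trans (cong σ (sym e₁)) e₂)
        fwd : R x × ρ x ≡ x → (R x × τ x ≡ x) ⊎ (R x × σ (τ x) ≡ x)
        fwd (r , e) with ρ-cases x
        ... | τ-lower _ e′ = inj₁ (r , trans (sym e′) e)
        ... | τ-upper _ e′ = inj₂ (r , trans (sym e′) e)
        bwd : (R x × τ x ≡ x) ⊎ (R x × σ (τ x) ≡ x) → R x × ρ x ≡ x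
        bwd (inj₁ (r , e)) with ρ-cases x
        ... | τ-lower _ e′ = r , trans e′ e
        ... | τ-upper ¬l _ = ⊥-elim (¬l (subst₂ (λ a b → idx a ℕ.< idx b) (sym e) (cong σ (sym e)) (proj₂ r)))
        bwd (inj₂ (r , e)) with ρ-cases x
        ... | τ-upper _ e′ = r , trans e′ e
        ... | τ-lower l _  = ⊥-elim (ℕP.<-asym (proj₂ r) (subst₂ (λ a b → idx a ℕ.< idx b) τx≡σx e l))
          where
          τx≡σx : τ x ≡ σ x
          τx≡σx = trans (sym (σ-involutive (τ x) (τ-closed x (proj₁ r)))) (cong σ e)

      -- σ acts without fixed points on Fix τ and on Fix στ, pairing them off.
      Fixed-τ-closed : ∀ x → X x × τ x ≡ x → X (σ x) × τ (σ x) ≡ σ x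
      Fixed-τ-closed x (x∈X , e) = σ-closed x x∈X , trans (sym (στ≡τσ x x∈X)) (cong σ e)

      Fixed-τ-halves : count Fixed-τ? ≡ count R∩Fixed-τ? ℕ.+ count R∩Fixed-τ?
      Fixed-τ-halves = trans (On.parity-free (λ x (x∈X , e) e′ → no-common-fixed-point x x∈X e′ e))
                             (cong (λ n → n ℕ.+ n) (∑-cong (λ x → 𝟙-⇔ (On.Lower? x) (R∩Fixed-τ? x)
                               (λ ((x∈X , e) , l) → (x∈X , l) , e) (λ ((x∈X , l) , e) → (x∈X , e) , l))))
        where module On = Involution Fixed-τ? σ Fixed-τ-closed (λ x → σ-involutive x ∘ proj₁)

      τx≡σx : ∀ x → X x → σ (τ x) ≡ x → τ x ≡ σ x
      τx≡σx x x∈X e = trans (sym (σ-involutive (τ x) (τ-closed x x∈X))) (cong σ e)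

      Fixed-στ-closed : ∀ x → X x × σ (τ x) ≡ x → X (σ x) × σ (τ (σ x)) ≡ σ x
      Fixed-στ-closed x (x∈X , e) = σ-closed x x∈X ,
        trans (cong σ (sym (στ≡τσ x x∈X))) (trans (σ-involutive (τ x) (τ-closed x x∈X)) (τx≡σx x x∈X e))

      Fixed-στ-halves : count Fixed-στ? ≡ count R∩Fixed-στ? ℕ.+ count R∩Fixed-στ?
      Fixed-στ-halves = trans (On.parity-free (λ x (x∈X , e) e′ → no-common-fixed-point x x∈X e′ (trans (τx≡σx x x∈X e) e′)))
                              (cong (λ n → n ℕ.+ n) (∑-cong (λ x → 𝟙-⇔ (On.Lower? x) (R∩Fixed-στ? x)
                                (λ ((x∈X , e) , l) → (x∈X , l) , e) (λ ((x∈X , l) , e) → (x∈X , e) , l))))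
        where module On = Involution Fixed-στ? σ Fixed-στ-closed (λ x → σ-involutive x ∘ proj₁)

    klein : Σ ℕ λ k → count X? ≡ count Fixed-σ? ℕ.+ (count Fixed-τ? ℕ.+ (count Fixed-στ? ℕ.+ ((k ℕ.+ k) ℕ.+ (k ℕ.+ k))))
    klein = L , (begin
      count X?                                      ≡⟨ Byσ.parity ⟩
      count Fixed-σ? ℕ.+ (count R? ℕ.+ count R?)    ≡⟨ cong (λ r → count Fixed-σ? ℕ.+ (r ℕ.+ r)) count-R ⟩
      count Fixed-σ? ℕ.+ ((a ℕ.+ b ℕ.+ (L ℕ.+ L)) ℕ.+ (a ℕ.+ b ℕ.+ (L ℕ.+ L)))
        ≡⟨ cong (count Fixed-σ? ℕ.+_) (regroup a b L) ⟩
      count Fixed-σ? ℕ.+ ((a ℕ.+ a) ℕ.+ ((b ℕ.+ b) ℕ.+ ((L ℕ.+ L) ℕ.+ (L ℕ.+ L))))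
        ≡⟨ sym (cong₂ (λ u v → count Fixed-σ? ℕ.+ (u ℕ.+ (v ℕ.+ ((L ℕ.+ L) ℕ.+ (L ℕ.+ L))))) Fixed-τ-halves Fixed-στ-halves) ⟩
      count Fixed-σ? ℕ.+ (count Fixed-τ? ℕ.+ (count Fixed-στ? ℕ.+ ((L ℕ.+ L) ℕ.+ (L ℕ.+ L)))) ∎)
      where
      a = count R∩Fixed-τ?
      b = count R∩Fixed-στ?
      L = count Byρ.Lower?
      count-R : count R? ≡ a ℕ.+ b ℕ.+ (L ℕ.+ L)
      count-R = trans Byρ.parity (cong (ℕ._+ (L ℕ.+ L))
                  (trans (∑-cong Fixed-ρ-split) (∑-+ (λ x → 𝟙[ R∩Fixed-τ? x ]) (λ x → 𝟙[ R∩Fixed-στ? x ]))))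
      regroup : ∀ a b L → (a ℕ.+ b ℕ.+ (L ℕ.+ L)) ℕ.+ (a ℕ.+ b ℕ.+ (L ℕ.+ L)) ≡ (a ℕ.+ a) ℕ.+ ((b ℕ.+ b) ℕ.+ ((L ℕ.+ L) ℕ.+ (L ℕ.+ L)))
      regroup = solve-∀

  module OddOrder (h : ℕ) (q≡2h+1 : q ≡ suc (h ℕ.+ h)) where

    2F : Carrier
    2F = 1F +F 1F

    -- Otherwise x ↦ x + 1 would be a fixed-point-free involution of F, making q even.
    2≢0 : 2F ≢ 0F
    2≢0 2≡0 = even≢odd (count Shift.Lower?) h (trans (sym pairs) q≡2h+1)
      where
      shift : Carrier → Carrier
      shift x = x +F 1F
      shift-involutive : ∀ x → shift (shift x) ≡ x
      shift-involutive x = begin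
        x +F 1F +F 1F   ≡⟨ solve 2 (λ x o → x :+ o :+ o := x :+ (o :+ o)) refl x 1F ⟩
        x +F 2F         ≡⟨ cong (x +F_) 2≡0 ⟩
        x +F 0F         ≡⟨ solve 1 (λ x → x :+ :0 := x) refl x ⟩
        x               ∎
      shift-free : ∀ x → shift x ≢ x
      shift-free x e = 1≢0 (trans (solve 2 (λ x o → o := (x :+ o) :- x) refl x 1F)
                               (trans (cong (_-F x) e) (solve 1 (λ x → x :- x := :0) refl x)))
      module Shift = Involution (λ _ → yes tt) shift (λ _ _ → tt) (λ x _ → shift-involutive x)
      pairs : q ≡ count Shift.Lower? ℕ.+ count Shift.Lower?
      pairs = trans (sym ∑-ones) (Shift.parity-free (λ x _ → shift-free x))

    x≢-x : ∀ x → x ≢ 0F → x ≢ -F x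
    x≢-x x x≢0 e with zero-divisor 2F x (trans (solve 1 (λ x → (:1 :+ :1) :* x := x :+ x) refl x)
                                            (trans (cong (x +F_) e) (solve 1 (λ x → x :+ (:- x) := :0) refl x)))
    ... | inj₁ 2≡0 = 2≢0 2≡0
    ... | inj₂ x≡0 = x≢0 x≡0

    NonzeroSquare : Carrier → Set
    NonzeroSquare x = x ≢ 0F × IsSquare x

    NonzeroSquare? : ∀ x → Dec (NonzeroSquare x)
    NonzeroSquare? x = ¬? (x ≟ 0F) ×-dec isSquare? x

    private
      Root? : ∀ y x → Dec (x ≢ 0F × x * x ≡ y)
      Root? y x = ¬? (x ≟ 0F) ×-dec ((x * x) ≟ y)

      roots-of-square : ∀ y → count (Root? y) ≡ 𝟙[ NonzeroSquare? y ] ℕ.+ 𝟙[ NonzeroSquare? y ]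
      roots-of-square y with NonzeroSquare? y
      ... | no ¬nzs = count-∅ (Root? y) (λ x (x≢0 , x²≡y) → ¬nzs ((λ y≡0 → square-nonzero x≢0 (trans x²≡y y≡0)) , square x y x²≡y))
      ... | yes (y≢0 , s) with square-root s
      ...   | r , r²≡y = trans (∑-cong (λ x → 𝟙-⇔ (Root? y x) ((x ≟ r) ⊎-dec (x ≟ (-F r))) fwd bwd))
                               (count-pair r (-F r) (x≢-x r r≢0))
        where
        r≢0 : r ≢ 0F
        r≢0 r≡0 = y≢0 (trans (sym r²≡y) (trans (cong (λ z → z * z) r≡0) (0*x 0F)))
        fwd : ∀ {x} → x ≢ 0F × x * x ≡ y → x ≡ r ⊎ x ≡ -F r
        fwd {x} (_ , x²≡y) = square-roots x r (trans x²≡y (sym r²≡y))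
        -r≢0 : -F r ≢ 0F
        -r≢0 e = r≢0 (trans (solve 1 (λ r → r := :- (:- r)) refl r) (trans (cong -F_ e) (solve 0 (:- :0 := :0) refl)))
        bwd : ∀ {x} → x ≡ r ⊎ x ≡ -F r → x ≢ 0F × x * x ≡ y
        bwd (inj₁ refl) = r≢0 , r²≡y
        bwd (inj₂ refl) = -r≢0 , trans (solve 1 (λ r → (:- r) :* (:- r) := r :* r) refl r) r²≡y

      -- Counting the pairs (x, x²) with x ≠ 0 in two ways.
      squares-twice : count NonzeroSquare? ℕ.+ count NonzeroSquare? ℕ.+ 1 ≡ q
      squares-twice = begin
        count NonzeroSquare? ℕ.+ count NonzeroSquare? ℕ.+ 1
          ≡⟨ cong (ℕ._+ 1) (sym (∑-+ (λ y → 𝟙[ NonzeroSquare? y ]) (λ y → 𝟙[ NonzeroSquare? y ]))) ⟩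
        ∑ (λ y → 𝟙[ NonzeroSquare? y ] ℕ.+ 𝟙[ NonzeroSquare? y ]) ℕ.+ 1
          ≡⟨ cong (ℕ._+ 1) (trans (sym (∑-cong roots-of-square)) (∑ℕ.∑-swap (λ y x → 𝟙[ Root? y x ]))) ⟩
        ∑ (λ x → ∑ (λ y → 𝟙[ Root? y x ])) ℕ.+ 1
          ≡⟨ cong (ℕ._+ 1) (∑-cong (λ x → image-of x (x ≟ 0F))) ⟩
        count (¬? ∘ (_≟ 0F)) ℕ.+ 1
          ≡⟨ trans (ℕP.+-comm _ 1) (cong (ℕ._+ count (¬? ∘ (_≟ 0F))) (sym (count-≡ 0F))) ⟩
        count (_≟ 0F) ℕ.+ count (¬? ∘ (_≟ 0F))
          ≡⟨ count-complement (_≟ 0F) ⟩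
        q ∎
        where
        image-of : ∀ x → Dec (x ≡ 0F) → ∑ (λ y → 𝟙[ Root? y x ]) ≡ 𝟙[ ¬? (x ≟ 0F) ]
        image-of x (yes x≡0) = trans (count-∅ (λ y → Root? y x) (λ _ (x≢0 , _) → x≢0 x≡0)) (sym (𝟙-no (¬? (x ≟ 0F)) (λ x≢0 → x≢0 x≡0)))
        image-of x (no x≢0)  = trans (∑-cong (λ y → 𝟙-⇔ (Root? y x) (y ≟ (x * x)) (sym ∘ proj₂) (λ e → x≢0 , sym e)))
                                     (trans (count-≡ (x * x)) (sym (𝟙-yes (¬? (x ≟ 0F)) x≢0)))

    count-NonzeroSquare : count NonzeroSquare? ≡ h
    count-NonzeroSquare = double-injective (count NonzeroSquare?) h (ℕP.suc-injective (trans (trans (ℕP.+-comm 1 _) squares-twice) q≡2h+1))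

    count-nonsquare : count (¬? ∘ isSquare?) ≡ h
    count-nonsquare = ℕP.+-cancelʳ-≡ h _ h (ℕP.suc-injective (begin
      suc (count (¬? ∘ isSquare?) ℕ.+ h)                        ≡⟨ cong suc (ℕP.+-comm _ h) ⟩
      suc (h ℕ.+ count (¬? ∘ isSquare?))                        ≡⟨ cong (λ n → suc n ℕ.+ count (¬? ∘ isSquare?)) (sym count-NonzeroSquare) ⟩
      suc (count NonzeroSquare?) ℕ.+ count (¬? ∘ isSquare?)     ≡⟨ cong (ℕ._+ count (¬? ∘ isSquare?)) squares ⟩
      count isSquare? ℕ.+ count (¬? ∘ isSquare?)                ≡⟨ count-complement isSquare? ⟩
      q                                                          ≡⟨ q≡2h+1 ⟩
      suc (h ℕ.+ h)                                              ∎))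
      where
      split : ∀ x → 𝟙[ isSquare? x ] ≡ 𝟙[ NonzeroSquare? x ] ℕ.+ 𝟙[ x ≟ 0F ]
      split x with x ≟ 0F | isSquare? x
      ... | yes x≡0 | no ¬s = ⊥-elim (¬s (subst IsSquare (sym x≡0) IsSquare-0))
      ... | yes _   | yes _ = refl
      ... | no _    | yes _ = refl
      ... | no _    | no _  = refl
      squares : suc (count NonzeroSquare?) ≡ count isSquare?
      squares = sym (trans (∑-cong split) (trans (∑-+ (λ x → 𝟙[ NonzeroSquare? x ]) (λ x → 𝟙[ x ≟ 0F ]))
                       (trans (cong (count NonzeroSquare? ℕ.+_) (count-≡ 0F)) (ℕP.+-comm _ 1))))

    -- The product of two nonsquares is a square: multiplication by a
    -- nonsquare c permutes F, so the nonsquares of the form c·x are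
    -- exactly as many as the nonzero squares x, leaving no room for
    -- nonsquares x with c·x a nonsquare.
    nonsquare-*-nonsquare : ∀ c x → ¬ IsSquare c → ¬ IsSquare x → IsSquare (c * x)
    nonsquare-*-nonsquare c x ¬sc ¬sx with isSquare? (c * x)
    ... | yes scx  = scx
    ... | no ¬scx  = ⊥-elim (count≡0 Both? no-both x (¬sx , ¬scx))
      where
      c≢0 = nonsquare-nonzero ¬sc
      Both? : ∀ y → Dec (¬ IsSquare y × ¬ IsSquare (c * y))
      Both? y = ¬? (isSquare? y) ×-dec ¬? (isSquare? (c * y))
      split : ∀ y → 𝟙[ ¬? (isSquare? (c * y)) ] ≡ 𝟙[ NonzeroSquare? y ] ℕ.+ 𝟙[ Both? y ]
      split y with y ≟ 0F | isSquare? y | isSquare? (c * y)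
      ... | yes y≡0 | _      | no ¬scy = ⊥-elim (¬scy (subst IsSquare (sym (trans (cong (c *_) y≡0) (solve 1 (λ c → c :* :0 := :0) refl c))) IsSquare-0))
      ... | yes y≡0 | no ¬sy | yes _   = ⊥-elim (¬sy (subst IsSquare (sym y≡0) IsSquare-0))
      ... | yes _   | yes _  | yes _   = refl
      ... | no y≢0  | yes sy | yes scy = ⊥-elim (nonsquare-*-square c y ¬sc y≢0 sy scy)
      ... | no _    | yes _  | no _    = refl
      ... | no _    | no _   | yes _   = refl
      ... | no _    | no _   | no _    = refl
      scale-inverse : ∀ y → c * (inv c * y) ≡ y
      scale-inverse y = trans (solve 3 (λ c i y → c :* (i :* y) := (c :* i) :* y) refl c (inv c) y)
                              (trans (cong (_* y) (x*inv-x c c≢0)) (solve 1 (λ y → :1 :* y := y) refl y))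
      inverse-scale : ∀ y → inv c * (c * y) ≡ y
      inverse-scale y = trans (solve 3 (λ c i y → i :* (c :* y) := (i :* c) :* y) refl c (inv c) y)
                              (trans (cong (_* y) (inv-x*x c c≢0)) (solve 1 (λ y → :1 :* y := y) refl y))
      no-both : count Both? ≡ 0
      no-both = ℕP.+-cancelˡ-≡ h _ 0 (begin
        h ℕ.+ count Both?                       ≡⟨ cong (ℕ._+ count Both?) (sym count-NonzeroSquare) ⟩
        count NonzeroSquare? ℕ.+ count Both?    ≡⟨ sym (∑-+ (λ y → 𝟙[ NonzeroSquare? y ]) (λ y → 𝟙[ Both? y ])) ⟩
        ∑ (λ y → 𝟙[ NonzeroSquare? y ] ℕ.+ 𝟙[ Both? y ]) ≡⟨ sym (∑-cong split) ⟩
        count (¬? ∘ isSquare? ∘ (c *_))         ≡⟨ ∑ℕ.∑-reindex (c *_) (inv c *_) scale-inverse inverse-scale (λ y → 𝟙[ ¬? (isSquare? y) ]) ⟩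
        count (¬? ∘ isSquare?)                  ≡⟨ count-nonsquare ⟩
        h                                       ≡⟨ sym (ℕP.+-identityʳ h) ⟩
        h ℕ.+ 0                                 ∎)

    χ₂-nonsquare-factor : ∀ c → ¬ IsSquare c → ∀ g → χ₂ (c * g) ≡ - χ₂ g
    χ₂-nonsquare-factor c ¬sc g = by-cases (g ≟ 0F) (isSquare? g)
      where
      by-cases : Dec (g ≡ 0F) → Dec (IsSquare g) → χ₂ (c * g) ≡ - χ₂ g
      by-cases (yes g≡0) _ = trans (χ₂-zero (c * g) (trans (cong (c *_) g≡0) (solve 1 (λ c → c :* :0 := :0) refl c))) (cong -_ (sym (χ₂-zero g g≡0)))
      by-cases (no g≢0) (yes sg) = trans (χ₂-nonsquare (c * g) (nonsquare-*-square c g ¬sc g≢0 sg)) (cong -_ (sym (χ₂-square g g≢0 sg)))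
      by-cases (no g≢0) (no ¬sg) = trans (χ₂-square (c * g) (*-nonzero (nonsquare-nonzero ¬sc) g≢0) (nonsquare-*-nonsquare c g ¬sc ¬sg)) (cong -_ (sym (χ₂-nonsquare g ¬sg)))

    -- If q ≡ 1 (mod 4), then -1 is a square: otherwise x ↦ x⁻¹ would be an
    -- involution of the h nonzero squares with the single fixed point 1.
    -1-square : ∀ t → h ≡ t ℕ.+ t → IsSquare (-F 1F)
    -1-square t h≡2t with isSquare? (-F 1F)
    ... | yes s = s
    ... | no ¬s = ⊥-elim (even≢odd t (count ByInv.Lower?) (begin
      t ℕ.+ t                   ≡⟨ sym h≡2t ⟩
      h                         ≡⟨ sym count-NonzeroSquare ⟩
      count NonzeroSquare?      ≡⟨ ByInv.parity ⟩
      count ByInv.Fixed? ℕ.+ (count ByInv.Lower? ℕ.+ count ByInv.Lower?)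
                                ≡⟨ cong (ℕ._+ (count ByInv.Lower? ℕ.+ count ByInv.Lower?)) (trans (∑-cong fixed-points) (count-≡ 1F)) ⟩
      suc (count ByInv.Lower? ℕ.+ count ByInv.Lower?) ∎))
      where
      inv-closed : ∀ x → NonzeroSquare x → NonzeroSquare (inv x)
      inv-closed x (x≢0 , sx) = inv-nonzero x x≢0 , IsSquare-inv sx
      module ByInv = Involution NonzeroSquare? inv inv-closed (λ x _ → inv-involutive x)
      fixed-points : ∀ x → 𝟙[ ByInv.Fixed? x ] ≡ 𝟙[ x ≟ 1F ]
      fixed-points x = 𝟙-⇔ (ByInv.Fixed? x) (x ≟ 1F) fwd bwd
        where
        fwd : NonzeroSquare x × inv x ≡ x → x ≡ 1F
        fwd ((x≢0 , sx) , e) with square-roots x 1F (trans (cong (x *_) (sym e)) (trans (x*inv-x x x≢0) (solve 0 (:1 := :1 :* :1) refl)))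
        ... | inj₁ x≡1  = x≡1
        ... | inj₂ x≡-1 = ⊥-elim (¬s (subst IsSquare x≡-1 sx))
        bwd : x ≡ 1F → NonzeroSquare x × inv x ≡ x
        bwd refl = (1≢0 , IsSquare-1) , inv-1

  cubic : Carrier → Carrier → Carrier
  cubic d x = x * (x -F 1F) * (x -F d)

  traceA≡∑ : ∀ d → traceA d ≡ - ∑ℤ.∑ (χ₂ ∘ cubic d)
  traceA≡∑ d = cong -_ (∑ℤ.∑-elements (χ₂ ∘ cubic d))

  -- For a nonsquare d, the substitution x = y/d gives A(1/d) = -A(d):
  -- cubic (1/d) (y/d) = d · (1/d)⁴ · cubic d y.
  module TraceInversion (h : ℕ) (q≡2h+1 : q ≡ suc (h ℕ.+ h)) where
    open OddOrder h q≡2h+1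

    traceA-inv : ∀ d → ¬ IsSquare d → traceA (inv d) ≡ - traceA d
    traceA-inv d ¬sd = begin
      traceA e                                   ≡⟨ traceA≡∑ e ⟩
      - ∑ℤ.∑ (χ₂ ∘ cubic e)                      ≡⟨ cong -_ (sym (∑ℤ.∑-reindex (e *_) (d *_) e*d* d*e* (χ₂ ∘ cubic e))) ⟩
      - ∑ℤ.∑ (λ y → χ₂ (cubic e (e * y)))        ≡⟨ cong -_ (∑ℤ.∑-cong (λ y → trans (cong χ₂ (substitution y)) (χ-factors y))) ⟩
      - ∑ℤ.∑ (λ y → - χ₂ (cubic d y))            ≡⟨ cong -_ (∑ℤ-neg (χ₂ ∘ cubic d)) ⟩
      - (- ∑ℤ.∑ (χ₂ ∘ cubic d))                  ≡⟨ cong -_ (sym (traceA≡∑ d)) ⟩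
      - traceA d                                 ∎
      where
      e = inv d
      d≢0 = nonsquare-nonzero ¬sd
      de≡1 : d * e ≡ 1F
      de≡1 = x*inv-x d d≢0
      e*d* : ∀ x → e * (d * x) ≡ x
      e*d* x = trans (solve 3 (λ d e x → e :* (d :* x) := (d :* e) :* x) refl d e x) (trans (cong (_* x) de≡1) (solve 1 (λ x → :1 :* x := x) refl x))
      d*e* : ∀ x → d * (e * x) ≡ x
      d*e* x = trans (solve 3 (λ d e x → d :* (e :* x) := (d :* e) :* x) refl d e x) (trans (cong (_* x) de≡1) (solve 1 (λ x → :1 :* x := x) refl x))
      substitution : ∀ y → cubic e (e * y) ≡ d * ((e * e) * (e * e) * cubic d y)
      substitution y = begin
        (e * y) * ((e * y) -F 1F) * ((e * y) -F e)       ≡⟨ cong (λ z → (e * y) * ((e * y) -F z) * ((e * y) -F e)) (sym de≡1) ⟩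
        (e * y) * ((e * y) -F (d * e)) * ((e * y) -F e)  ≡⟨ solve 3 (λ d e y → (e :* y) :* ((e :* y) :- (d :* e)) :* ((e :* y) :- e)
                                                                  := (e :* e :* e :* (y :* (y :- :1) :* (y :- d))) :* :1) refl d e y ⟩
        (e * e * e * cubic d y) * 1F                      ≡⟨ cong ((e * e * e * cubic d y) *_) (sym de≡1) ⟩
        (e * e * e * cubic d y) * (d * e)                 ≡⟨ solve 3 (λ d e g → (e :* e :* e :* g) :* (d :* e) := d :* ((e :* e) :* (e :* e) :* g)) refl d e (cubic d y) ⟩
        d * ((e * e) * (e * e) * cubic d y)               ∎
      χ-factors : ∀ y → χ₂ (d * ((e * e) * (e * e) * cubic d y)) ≡ - χ₂ (cubic d y)
      χ-factors y = trans (χ₂-nonsquare-factor d ¬sd _)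
                          (cong -_ (χ₂-square-factor (e * e) (square-nonzero (inv-nonzero d d≢0)) (cubic d y)))

    Nn2-symmetric : ∀ A → Nn2 A ≡ Nn2 (- A)
    Nn2-symmetric A = begin
      Nn2 A                           ≡⟨ count-filter (Counted-nonsquare? A) ⟩
      count (Counted-nonsquare? A)    ≡⟨ sym (∑ℕ.∑-reindex inv inv inv-involutive inv-involutive (λ d → 𝟙[ Counted-nonsquare? A d ])) ⟩
      ∑ (λ d → 𝟙[ Counted-nonsquare? A (inv d) ]) ≡⟨ ∑-cong (λ d → 𝟙-⇔ (Counted-nonsquare? A (inv d)) (Counted-nonsquare? (- A) d) (fwd d) (bwd d)) ⟩
      count (Counted-nonsquare? (- A)) ≡⟨ sym (count-filter (Counted-nonsquare? (- A))) ⟩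
      Nn2 (- A)                       ∎
      where
      Counted-nonsquare? : ∀ A d → Dec ((d ≢ 0F × d ≢ 1F × traceA d ≡ A) × ¬ IsSquare d)
      Counted-nonsquare? A d = Counted? A d ×-dec ¬? (isSquare? d)
      ¬square-inv : ∀ {d} → ¬ IsSquare (inv d) → ¬ IsSquare d
      ¬square-inv ¬s = ¬s ∘ IsSquare-inv
      fwd : ∀ d → (inv d ≢ 0F × inv d ≢ 1F × traceA (inv d) ≡ A) × ¬ IsSquare (inv d) →
                  (d ≢ 0F × d ≢ 1F × traceA d ≡ - A) × ¬ IsSquare d
      fwd d ((i≢0 , i≢1 , trace) , ¬si) =
        ( (λ d≡0 → i≢0 (trans (cong inv d≡0) inv-0))
        , (λ d≡1 → i≢1 (trans (cong inv d≡1) inv-1))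
        , trans (sym (ℤP.neg-involutive (traceA d))) (cong -_ (trans (sym (traceA-inv d ¬sd)) trace)) )
        , ¬sd
        where ¬sd = ¬square-inv ¬si
      bwd : ∀ d → (d ≢ 0F × d ≢ 1F × traceA d ≡ - A) × ¬ IsSquare d →
                  (inv d ≢ 0F × inv d ≢ 1F × traceA (inv d) ≡ A) × ¬ IsSquare (inv d)
      bwd d ((d≢0 , d≢1 , trace) , ¬sd) =
        ( inv-nonzero d d≢0
        , (λ i≡1 → d≢1 (trans (sym (inv-involutive d)) (trans (cong inv i≡1) inv-1)))
        , trans (traceA-inv d ¬sd) (trans (cong -_ trace) (ℤP.neg-involutive A)) )
        , ¬square-inv (subst (¬_ ∘ IsSquare) (sym (inv-involutive d)) ¬sd)

  module SquareParameter (t : ℕ) (q≡4t+1 : q ≡ suc ((t ℕ.+ t) ℕ.+ (t ℕ.+ t)))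
                         (d : Carrier) (d≢0 : d ≢ 0F) (d≢1 : d ≢ 1F) (square-d : IsSquare d) where
    open OddOrder (t ℕ.+ t) q≡4t+1

    s : Carrier
    s = proj₁ (square-root square-d)

    s²≡d : s * s ≡ d
    s²≡d = proj₂ (square-root square-d)

    i : Carrier
    i = proj₁ (square-root (-1-square t refl))

    i²≡-1 : i * i ≡ -F 1F
    i²≡-1 = proj₂ (square-root (-1-square t refl))

    f : Carrier → Carrier
    f = cubic d

    -- The x-coordinates of the points of L_d with y ≠ 0, each giving two points.
    X : Carrier → Set
    X x = NonzeroSquare (f x)

    X? : ∀ x → Dec (X x)
    X? x = NonzeroSquare? (f x)

    f-root : ∀ {x} → x ≡ 0F ⊎ x ≡ 1F ⊎ x ≡ d → f x ≡ 0F
    f-root (inj₁ refl)        = solve 1 (λ d → :0 :* (:0 :- :1) :* (:0 :- d) := :0) refl d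
    f-root (inj₂ (inj₁ refl)) = solve 1 (λ d → :1 :* (:1 :- :1) :* (:1 :- d) := :0) refl d
    f-root (inj₂ (inj₂ refl)) = solve 1 (λ d → d :* (d :- :1) :* (d :- d) := :0) refl d

    f-roots : ∀ {x} → f x ≡ 0F → x ≡ 0F ⊎ x ≡ 1F ⊎ x ≡ d
    f-roots {x} fx≡0 with zero-divisor (x * (x -F 1F)) (x -F d) fx≡0
    ... | inj₂ x-d≡0 = inj₂ (inj₂ (difference≡0 x-d≡0))
    ... | inj₁ x[x-1]≡0 with zero-divisor x (x -F 1F) x[x-1]≡0
    ...   | inj₁ x≡0   = inj₁ x≡0
    ...   | inj₂ x-1≡0 = inj₂ (inj₁ (difference≡0 x-1≡0))

    f-nonzero : ∀ {x} → x ≢ 0F → x ≢ 1F → x ≢ d → f x ≢ 0F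
    f-nonzero x≢0 x≢1 x≢d = *-nonzero (*-nonzero x≢0 (difference≢0 x≢1)) (difference≢0 x≢d)

    X⇒≢0 : ∀ {x} → X x → x ≢ 0F
    X⇒≢0 (fx≢0 , _) = fx≢0 ∘ f-root ∘ inj₁

    X⇒≢1 : ∀ {x} → X x → x ≢ 1F
    X⇒≢1 (fx≢0 , _) = fx≢0 ∘ f-root ∘ inj₂ ∘ inj₁

    X⇒≢d : ∀ {x} → X x → x ≢ d
    X⇒≢d (fx≢0 , _) = fx≢0 ∘ f-root ∘ inj₂ ∘ inj₂

    X-rescale : ∀ {x x′} u → u ≢ 0F → f x′ ≡ u * u * f x → X x → X x′
    X-rescale u u≢0 e (fx≢0 , sfx) = subst NonzeroSquare (sym e)
      (*-nonzero (square-nonzero u≢0) fx≢0 , IsSquare-* (square u (u * u) refl) sfx)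

    -- σ(x) = d/x, the translation by the 2-torsion point (0, 0) in x-coordinates.
    σ : Carrier → Carrier
    σ x = d * inv x

    σ-scales-f : ∀ x → x ≢ 0F → f (σ x) ≡ (d * (inv x * inv x)) * (d * (inv x * inv x)) * f x
    σ-scales-f x x≢0 = sym (begin
      (d * (e * e)) * (d * (e * e)) * (x * (x -F 1F) * (x -F d))
        ≡⟨ solve 3 (λ d e x → (d :* (e :* e)) :* (d :* (e :* e)) :* (x :* (x :- :1) :* (x :- d))
                   := d :* d :* e :* (e :* x) :* ((e :* x) :- e) :* ((e :* x) :- d :* e)) refl d e x ⟩
      d * d * e * (e * x) * ((e * x) -F e) * ((e * x) -F (d * e))
        ≡⟨ cong (λ z → d * d * e * z * (z -F e) * (z -F (d * e))) (inv-x*x x x≢0) ⟩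
      d * d * e * 1F * (1F -F e) * (1F -F (d * e))
        ≡⟨ solve 2 (λ d e → d :* d :* e :* :1 :* (:1 :- e) :* (:1 :- d :* e) := (d :* e) :* ((d :* e) :- :1) :* ((d :* e) :- d)) refl d e ⟩
      (d * e) * ((d * e) -F 1F) * ((d * e) -F d) ∎)
      where e = inv x

    σ-closed : ∀ x → X x → X (σ x)
    σ-closed x x∈X = X-rescale _ (*-nonzero d≢0 (square-nonzero (inv-nonzero x (X⇒≢0 x∈X)))) (σ-scales-f x (X⇒≢0 x∈X)) x∈X

    σ-involutive : ∀ x → x ≢ 0F → σ (σ x) ≡ x
    σ-involutive x x≢0 = begin
      d * inv (d * inv x)     ≡⟨ cong (d *_) (inv-unique (d * inv x) (x * inv d) product≡1) ⟩
      d * (x * inv d)         ≡⟨ solve 3 (λ d x i → d :* (x :* i) := x :* (d :* i)) refl d x (inv d) ⟩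
      x * (d * inv d)         ≡⟨ cong (x *_) (x*inv-x d d≢0) ⟩
      x * 1F                  ≡⟨ solve 1 (λ x → x :* :1 := x) refl x ⟩
      x                       ∎
      where
      product≡1 : d * inv x * (x * inv d) ≡ 1F
      product≡1 = trans (solve 4 (λ d ix x id → d :* ix :* (x :* id) := (d :* id) :* (ix :* x)) refl d (inv x) x (inv d))
                        (trans (cong₂ _*_ (x*inv-x d d≢0) (inv-x*x x x≢0)) (solve 0 (:1 :* :1 := :1) refl))

    -- τ(x) = (x - d)/(x - 1), the translation by the 2-torsion point (1, 0).
    τ : Carrier → Carrier
    τ x = (x -F d) * inv (x -F 1F)

    1-d≢0 : 1F -F d ≢ 0F
    1-d≢0 = difference≢0 (d≢1 ∘ sym)

    module AtPoint (x : Carrier) (x≢1 : x ≢ 1F) where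
      w : Carrier
      w = inv (x -F 1F)

      w[x-1]≡1 : w * (x -F 1F) ≡ 1F
      w[x-1]≡1 = inv-x*x (x -F 1F) (difference≢0 x≢1)

      w≢0 : w ≢ 0F
      w≢0 = inv-nonzero (x -F 1F) (difference≢0 x≢1)

      τ-scales-f : f (τ x) ≡ ((1F -F d) * (w * w)) * ((1F -F d) * (w * w)) * f x
      τ-scales-f = begin
        y * (y -F 1F) * (y -F d)                            ≡⟨ solve 2 (λ y d → y :* (y :- :1) :* (y :- d) := y :* (y :- :1) :* (y :- d :* :1)) refl y d ⟩
        y * (y -F 1F) * (y -F (d * 1F))                     ≡⟨ cong₂ (λ a b → y * (y -F a) * (y -F (d * b))) (sym w[x-1]≡1) (sym w[x-1]≡1) ⟩
        y * (y -F (w * (x -F 1F))) * (y -F (d * (w * (x -F 1F))))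
          ≡⟨ solve 3 (λ x d w → ((x :- d) :* w) :* (((x :- d) :* w) :- w :* (x :- :1)) :* (((x :- d) :* w) :- d :* (w :* (x :- :1)))
                     := ((:1 :- d) :* (:1 :- d) :* w :* w :* w :* x :* (x :- d)) :* :1) refl x d w ⟩
        K * 1F                                              ≡⟨ cong (K *_) (sym w[x-1]≡1) ⟩
        K * (w * (x -F 1F))
          ≡⟨ solve 3 (λ x d w → ((:1 :- d) :* (:1 :- d) :* w :* w :* w :* x :* (x :- d)) :* (w :* (x :- :1))
                     := ((:1 :- d) :* (w :* w)) :* ((:1 :- d) :* (w :* w)) :* (x :* (x :- :1) :* (x :- d))) refl x d w ⟩
        ((1F -F d) * (w * w)) * ((1F -F d) * (w * w)) * f x ∎
        where
        y = τ x
        K = (1F -F d) * (1F -F d) * w * w * w * x * (x -F d)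

      τx-1 : τ x -F 1F ≡ (1F -F d) * w
      τx-1 = trans (cong (λ z → ((x -F d) * w) -F z) (sym w[x-1]≡1))
                   (solve 3 (λ x d w → (x :- d) :* w :- w :* (x :- :1) := (:1 :- d) :* w) refl x d w)

      τx-d : τ x -F d ≡ x * ((1F -F d) * w)
      τx-d = trans (solve 2 (λ y d → y :- d := y :- d :* :1) refl (τ x) d)
                   (trans (cong (λ z → ((x -F d) * w) -F (d * z)) (sym w[x-1]≡1))
                          (solve 3 (λ x d w → (x :- d) :* w :- d :* (w :* (x :- :1)) := x :* ((:1 :- d) :* w)) refl x d w))

      τ-involutive : τ (τ x) ≡ x
      τ-involutive = begin
        (τ x -F d) * inv (τ x -F 1F)   ≡⟨ cong₂ (λ a b → a * inv b) τx-d τx-1 ⟩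
        x * c * inv c                   ≡⟨ solve 3 (λ x c ic → x :* c :* ic := x :* (c :* ic)) refl x c (inv c) ⟩
        x * (c * inv c)                 ≡⟨ cong (x *_) (x*inv-x c (*-nonzero 1-d≢0 w≢0)) ⟩
        x * 1F                          ≡⟨ solve 1 (λ x → x :* :1 := x) refl x ⟩
        x                               ∎
        where c = (1F -F d) * w

    τ-closed : ∀ x → X x → X (τ x)
    τ-closed x x∈X = X-rescale _ (*-nonzero 1-d≢0 (square-nonzero w≢0)) τ-scales-f x∈X
      where open AtPoint x (X⇒≢1 x∈X)

    τ-involutive : ∀ x → X x → τ (τ x) ≡ x
    τ-involutive x x∈X = AtPoint.τ-involutive x (X⇒≢1 x∈X)

    στ≡τσ : ∀ x → X x → σ (τ x) ≡ τ (σ x)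
    στ≡τσ x x∈X = begin
      d * inv ((x -F d) * w)                         ≡⟨ cong (d *_) inv-τx ⟩
      d * ((x -F 1F) * inv (x -F d))                 ≡⟨ solve 3 (λ d m k → d :* (m :* k) := (d :* m) :* k) refl d (x -F 1F) (inv (x -F d)) ⟩
      d * (x -F 1F) * inv (x -F d)                   ≡⟨ fractions-equal (difference≢0 (X⇒≢d x∈X)) σx-1≢0 cross ⟩
      ((d * e) -F d) * inv ((d * e) -F 1F)           ∎
      where
      open AtPoint x (X⇒≢1 x∈X)
      e = inv x
      ex≡1 : e * x ≡ 1F
      ex≡1 = inv-x*x x (X⇒≢0 x∈X)
      inv-τx : inv ((x -F d) * w) ≡ (x -F 1F) * inv (x -F d)
      inv-τx = inv-unique _ _ (trans (solve 4 (λ a w m k → a :* w :* (m :* k) := (w :* m) :* (a :* k)) refl (x -F d) w (x -F 1F) (inv (x -F d)))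
                 (trans (cong₂ _*_ w[x-1]≡1 (x*inv-x (x -F d) (difference≢0 (X⇒≢d x∈X)))) (solve 0 (:1 :* :1 := :1) refl)))
      σx-1≢0 : (d * e) -F 1F ≢ 0F
      σx-1≢0 z = X⇒≢d x∈X (sym (begin
        d              ≡⟨ solve 1 (λ d → d := d :* :1) refl d ⟩
        d * 1F         ≡⟨ cong (d *_) (sym ex≡1) ⟩
        d * (e * x)    ≡⟨ solve 3 (λ d e x → d :* (e :* x) := x :* (d :* e)) refl d e x ⟩
        x * (d * e)    ≡⟨ cong (x *_) (difference≡0 z) ⟩
        x * 1F         ≡⟨ solve 1 (λ x → x :* :1 := x) refl x ⟩
        x              ∎))
      cross : (d * (x -F 1F)) * ((d * e) -F 1F) ≡ ((d * e) -F d) * (x -F d)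
      cross = begin
        (d * (x -F 1F)) * ((d * e) -F 1F)
          ≡⟨ solve 3 (λ d e x → (d :* (x :- :1)) :* ((d :* e) :- :1) := ((d :* e) :- d) :* (x :- d) :+ d :* (d :- :1) :* ((e :* x) :- :1)) refl d e x ⟩
        ((d * e) -F d) * (x -F d) +F d * (d -F 1F) * ((e * x) -F 1F)
          ≡⟨ cong (λ z → ((d * e) -F d) * (x -F d) +F d * (d -F 1F) * (z -F 1F)) ex≡1 ⟩
        ((d * e) -F d) * (x -F d) +F d * (d -F 1F) * (1F -F 1F)
          ≡⟨ solve 3 (λ d e x → ((d :* e) :- d) :* (x :- d) :+ d :* (d :- :1) :* (:1 :- :1) := ((d :* e) :- d) :* (x :- d)) refl d e x ⟩
        ((d * e) -F d) * (x -F d) ∎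

    -- A common fixed point would satisfy x² = d and x - d = x(x - 1),
    -- forcing 2x(x - 1) = 0.
    no-common-fixed-point : ∀ x → X x → σ x ≡ x → τ x ≡ x → ⊥
    no-common-fixed-point x x∈X σx≡x τx≡x with zero-divisor 2F (x * (x -F 1F)) 2x[x-1]≡0
      where
      d≡x² : d ≡ x * x
      d≡x² = clear-denominator (X⇒≢0 x∈X) σx≡x
      x-d≡x[x-1] : x -F d ≡ x * (x -F 1F)
      x-d≡x[x-1] = clear-denominator (difference≢0 (X⇒≢1 x∈X)) τx≡x
      2x[x-1]≡0 : 2F * (x * (x -F 1F)) ≡ 0F
      2x[x-1]≡0 = begin
        2F * (x * (x -F 1F))                ≡⟨ solve 1 (λ x → (:1 :+ :1) :* (x :* (x :- :1)) := x :* (x :- :1) :+ x :* (x :- :1)) refl x ⟩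
        x * (x -F 1F) +F x * (x -F 1F)      ≡⟨ cong (_+F x * (x -F 1F)) (sym x-d≡x[x-1]) ⟩
        (x -F d) +F x * (x -F 1F)           ≡⟨ cong (λ z → (x -F z) +F x * (x -F 1F)) d≡x² ⟩
        (x -F (x * x)) +F x * (x -F 1F)     ≡⟨ solve 1 (λ x → (x :- x :* x) :+ x :* (x :- :1) := :0) refl x ⟩
        0F                                  ∎
    ... | inj₁ 2≡0 = 2≢0 2≡0
    ... | inj₂ x[x-1]≡0 with zero-divisor x (x -F 1F) x[x-1]≡0
    ...   | inj₁ x≡0   = X⇒≢0 x∈X x≡0
    ...   | inj₂ x-1≡0 = X⇒≢1 x∈X (difference≡0 x-1≡0)

    module Klein = KleinFourGroup X? σ τ σ-closed τ-closed (λ x → σ-involutive x ∘ X⇒≢0) τ-involutive στ≡τσ no-common-fixed-point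

    root-is-fixed-by-σ : ∀ x → x * x ≡ d → X x × σ x ≡ x
    root-is-fixed-by-σ x x²≡d = (f-nonzero x≢0 x≢1 x≢d , square (i * x * (x -F 1F)) (f x) f≡square) , σx≡x
      where
      x≢0 : x ≢ 0F
      x≢0 x≡0 = d≢0 (trans (sym x²≡d) (trans (cong (λ z → z * z) x≡0) (0*x 0F)))
      x≢1 : x ≢ 1F
      x≢1 x≡1 = d≢1 (trans (sym x²≡d) (trans (cong (λ z → z * z) x≡1) (solve 0 (:1 :* :1 := :1) refl)))
      x≢d : x ≢ d
      x≢d x≡d with zero-divisor x (x -F 1F) (trans (solve 1 (λ x → x :* (x :- :1) := x :* x :- x) refl x)
                                                (trans (cong₂ _-F_ x²≡d x≡d) (solve 1 (λ d → d :- d := :0) refl d)))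
      ... | inj₁ x≡0   = x≢0 x≡0
      ... | inj₂ x-1≡0 = x≢1 (difference≡0 x-1≡0)
      f≡square : i * x * (x -F 1F) * (i * x * (x -F 1F)) ≡ f x
      f≡square = sym (begin
        x * (x -F 1F) * (x -F d)                      ≡⟨ cong (λ z → x * (x -F 1F) * (x -F z)) (sym x²≡d) ⟩
        x * (x -F 1F) * (x -F (x * x))                ≡⟨ solve 1 (λ x → x :* (x :- :1) :* (x :- x :* x) := (:- :1) :* (x :* (x :- :1)) :* (x :* (x :- :1))) refl x ⟩
        (-F 1F) * (x * (x -F 1F)) * (x * (x -F 1F))   ≡⟨ cong (λ z → z * (x * (x -F 1F)) * (x * (x -F 1F))) (sym i²≡-1) ⟩
        (i * i) * (x * (x -F 1F)) * (x * (x -F 1F))   ≡⟨ solve 2 (λ i x → (i :* i) :* (x :* (x :- :1)) :* (x :* (x :- :1)) := i :* x :* (x :- :1) :* (i :* x :* (x :- :1))) refl i x ⟩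
        i * x * (x -F 1F) * (i * x * (x -F 1F))       ∎)
      σx≡x : d * inv x ≡ x
      σx≡x = begin
        d * inv x           ≡⟨ cong (_* inv x) (sym x²≡d) ⟩
        x * x * inv x       ≡⟨ solve 2 (λ x k → x :* x :* k := x :* (x :* k)) refl x (inv x) ⟩
        x * (x * inv x)     ≡⟨ cong (x *_) (x*inv-x x x≢0) ⟩
        x * 1F              ≡⟨ solve 1 (λ x → x :* :1 := x) refl x ⟩
        x                   ∎

    count-Fixed-σ : count Klein.Fixed-σ? ≡ 2
    count-Fixed-σ = trans (∑-cong (λ x → 𝟙-⇔ (Klein.Fixed-σ? x) ((x ≟ s) ⊎-dec (x ≟ (-F s))) fwd bwd))
                          (count-pair s (-F s) (x≢-x s s≢0))
      where
      s≢0 : s ≢ 0F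
      s≢0 s≡0 = d≢0 (trans (sym s²≡d) (trans (cong (λ z → z * z) s≡0) (0*x 0F)))
      fwd : ∀ {x} → X x × σ x ≡ x → x ≡ s ⊎ x ≡ -F s
      fwd {x} (x∈X , σx≡x) = square-roots x s (trans (sym (clear-denominator (X⇒≢0 x∈X) σx≡x)) (sym s²≡d))
      bwd : ∀ {x} → x ≡ s ⊎ x ≡ -F s → X x × σ x ≡ x
      bwd (inj₁ refl) = root-is-fixed-by-σ s s²≡d
      bwd (inj₂ refl) = root-is-fixed-by-σ (-F s) (trans (solve 1 (λ s → (:- s) :* (:- s) := s :* s) refl s) s²≡d)

    FixedEquation-τ : Carrier → Set
    FixedEquation-τ x = (x -F 1F) * (x -F 1F) ≡ 1F -F d

    FixedEquation-τ? : ∀ x → Dec (FixedEquation-τ x)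
    FixedEquation-τ? x = ((x -F 1F) * (x -F 1F)) ≟ (1F -F d)

    FixedEquation-στ : Carrier → Set
    FixedEquation-στ x = (x -F d) * (x -F d) ≡ (d * d) -F d

    FixedEquation-στ? : ∀ x → Dec (FixedEquation-στ x)
    FixedEquation-στ? x = ((x -F d) * (x -F d)) ≟ ((d * d) -F d)

    -- τ x = x means x - d = x(x - 1), i.e. (x - 1)² = 1 - d; conversely f(x) is then (x - d)².
    Fixed-τ⇒equation : ∀ x → X x × τ x ≡ x → FixedEquation-τ x
    Fixed-τ⇒equation x (x∈X , τx≡x) = begin
      (x -F 1F) * (x -F 1F)          ≡⟨ solve 1 (λ x → (x :- :1) :* (x :- :1) := x :* (x :- :1) :- x :+ :1) refl x ⟩
      (x * (x -F 1F)) -F x +F 1F     ≡⟨ cong (λ z → z -F x +F 1F) (sym (clear-denominator (difference≢0 (X⇒≢1 x∈X)) τx≡x)) ⟩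
      (x -F d) -F x +F 1F            ≡⟨ solve 2 (λ x d → (x :- d) :- x :+ :1 := :1 :- d) refl x d ⟩
      1F -F d                        ∎

    equation⇒Fixed-τ : ∀ x → FixedEquation-τ x → X x × τ x ≡ x
    equation⇒Fixed-τ x eq = (f-nonzero x≢0 x≢1 x≢d , square (x -F d) (f x) (sym f≡square)) , τx≡x
      where
      x≢1 : x ≢ 1F
      x≢1 x≡1 = 1-d≢0 (trans (sym eq) (trans (cong (λ z → (z -F 1F) * (z -F 1F)) x≡1) (solve 0 ((:1 :- :1) :* (:1 :- :1) := :0) refl)))
      x≢0 : x ≢ 0F
      x≢0 x≡0 = d≢0 (begin
        d                                 ≡⟨ solve 1 (λ d → d := :1 :- (:1 :- d)) refl d ⟩
        1F -F (1F -F d)                   ≡⟨ cong (λ z → 1F -F z) (sym eq) ⟩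
        1F -F ((x -F 1F) * (x -F 1F))     ≡⟨ cong (λ z → 1F -F ((z -F 1F) * (z -F 1F))) x≡0 ⟩
        1F -F ((0F -F 1F) * (0F -F 1F))   ≡⟨ solve 0 (:1 :- ((:0 :- :1) :* (:0 :- :1)) := :0) refl ⟩
        0F                                ∎)
      x[x-1]≡x-d : x * (x -F 1F) ≡ x -F d
      x[x-1]≡x-d = begin
        x * (x -F 1F)                      ≡⟨ solve 1 (λ x → x :* (x :- :1) := (x :- :1) :* (x :- :1) :+ (x :- :1)) refl x ⟩
        (x -F 1F) * (x -F 1F) +F (x -F 1F) ≡⟨ cong (_+F (x -F 1F)) eq ⟩
        (1F -F d) +F (x -F 1F)             ≡⟨ solve 2 (λ x d → (:1 :- d) :+ (x :- :1) := x :- d) refl x d ⟩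
        x -F d                             ∎
      x≢d : x ≢ d
      x≢d x≡d with zero-divisor x (x -F 1F) (trans x[x-1]≡x-d (trans (cong (λ z → x -F z) (sym x≡d)) (solve 1 (λ x → x :- x := :0) refl x)))
      ... | inj₁ x≡0   = x≢0 x≡0
      ... | inj₂ x-1≡0 = x≢1 (difference≡0 x-1≡0)
      f≡square : f x ≡ (x -F d) * (x -F d)
      f≡square = cong (_* (x -F d)) x[x-1]≡x-d
      τx≡x : τ x ≡ x
      τx≡x = begin
        (x -F d) * inv (x -F 1F)              ≡⟨ cong (_* inv (x -F 1F)) (sym x[x-1]≡x-d) ⟩
        x * (x -F 1F) * inv (x -F 1F)         ≡⟨ solve 3 (λ x m k → x :* m :* k := x :* (m :* k)) refl x (x -F 1F) (inv (x -F 1F)) ⟩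
        x * ((x -F 1F) * inv (x -F 1F))       ≡⟨ cong (x *_) (x*inv-x (x -F 1F) (difference≢0 x≢1)) ⟩
        x * 1F                                ≡⟨ solve 1 (λ x → x :* :1 := x) refl x ⟩
        x                                     ∎

    count-Fixed-τ : count Klein.Fixed-τ? ≡ count FixedEquation-τ?
    count-Fixed-τ = ∑-cong (λ x → 𝟙-⇔ (Klein.Fixed-τ? x) (FixedEquation-τ? x) (Fixed-τ⇒equation x) (equation⇒Fixed-τ x))

    d²-d≢0 : (d * d) -F d ≢ 0F
    d²-d≢0 z with zero-divisor d (d -F 1F) (trans (solve 1 (λ d → d :* (d :- :1) := d :* d :- d) refl d) z)
    ... | inj₁ d≡0   = d≢0 d≡0
    ... | inj₂ d-1≡0 = d≢1 (difference≡0 d-1≡0)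

    -- στ x = x means τ x = σ x, i.e. x(x - d) = d(x - 1), i.e. (x - d)² = d² - d;
    -- conversely f(x) is then (s(x - 1))².
    Fixed-στ⇒equation : ∀ x → X x × σ (τ x) ≡ x → FixedEquation-στ x
    Fixed-στ⇒equation x (x∈X , στx≡x) = begin
      (x -F d) * (x -F d)                    ≡⟨ solve 2 (λ x d → (x :- d) :* (x :- d) := (x :- d) :* x :- d :* x :+ d :* d) refl x d ⟩
      ((x -F d) * x) -F (d * x) +F d * d     ≡⟨ cong (λ z → z -F (d * x) +F d * d) cross ⟩
      (d * (x -F 1F)) -F (d * x) +F d * d    ≡⟨ solve 2 (λ x d → d :* (x :- :1) :- d :* x :+ d :* d := d :* d :- d) refl x d ⟩
      (d * d) -F d                           ∎
      where
      τx≡σx : τ x ≡ σ x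
      τx≡σx = trans (sym (σ-involutive (τ x) (X⇒≢0 (τ-closed x x∈X)))) (cong σ στx≡x)
      cross : (x -F d) * x ≡ d * (x -F 1F)
      cross = fractions-equal⁻¹ (difference≢0 (X⇒≢1 x∈X)) (X⇒≢0 x∈X) τx≡σx

    equation⇒Fixed-στ : ∀ x → FixedEquation-στ x → X x × σ (τ x) ≡ x
    equation⇒Fixed-στ x eq = (f-nonzero x≢0 x≢1 x≢d , square (s * (x -F 1F)) (f x) (sym f≡square)) , στx≡x
      where
      x≢0 : x ≢ 0F
      x≢0 x≡0 = d≢0 (begin
        d                                   ≡⟨ solve 1 (λ d → d := d :* d :- (d :* d :- d)) refl d ⟩
        (d * d) -F ((d * d) -F d)           ≡⟨ cong (λ z → (d * d) -F z) (sym eq) ⟩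
        (d * d) -F ((x -F d) * (x -F d))    ≡⟨ cong (λ z → (d * d) -F ((z -F d) * (z -F d))) x≡0 ⟩
        (d * d) -F ((0F -F d) * (0F -F d))  ≡⟨ solve 1 (λ d → d :* d :- ((:0 :- d) :* (:0 :- d)) := :0) refl d ⟩
        0F                                  ∎)
      x≢d : x ≢ d
      x≢d x≡d = d²-d≢0 (trans (sym eq) (trans (cong (λ z → (z -F d) * (z -F d)) x≡d) (solve 1 (λ d → (d :- d) :* (d :- d) := :0) refl d)))
      x≢1 : x ≢ 1F
      x≢1 x≡1 = 1-d≢0 (begin
        1F -F d                                             ≡⟨ solve 1 (λ d → :1 :- d := (:1 :- d) :* (:1 :- d) :- (d :* d :- d)) refl d ⟩
        ((1F -F d) * (1F -F d)) -F ((d * d) -F d)           ≡⟨ cong (λ z → ((1F -F d) * (1F -F d)) -F z) (sym eq) ⟩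
        ((1F -F d) * (1F -F d)) -F ((x -F d) * (x -F d))    ≡⟨ cong (λ z → ((1F -F d) * (1F -F d)) -F ((z -F d) * (z -F d))) x≡1 ⟩
        ((1F -F d) * (1F -F d)) -F ((1F -F d) * (1F -F d))  ≡⟨ solve 1 (λ d → (:1 :- d) :* (:1 :- d) :- ((:1 :- d) :* (:1 :- d)) := :0) refl d ⟩
        0F                                                  ∎)
      x[x-d]≡d[x-1] : x * (x -F d) ≡ d * (x -F 1F)
      x[x-d]≡d[x-1] = begin
        x * (x -F d)                          ≡⟨ solve 2 (λ x d → x :* (x :- d) := (x :- d) :* (x :- d) :+ d :* (x :- d)) refl x d ⟩
        (x -F d) * (x -F d) +F d * (x -F d)   ≡⟨ cong (_+F d * (x -F d)) eq ⟩
        ((d * d) -F d) +F d * (x -F d)        ≡⟨ solve 2 (λ x d → (d :* d :- d) :+ d :* (x :- d) := d :* (x :- :1)) refl x d ⟩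
        d * (x -F 1F)                         ∎
      f≡square : f x ≡ s * (x -F 1F) * (s * (x -F 1F))
      f≡square = begin
        x * (x -F 1F) * (x -F d)              ≡⟨ solve 2 (λ x d → x :* (x :- :1) :* (x :- d) := (x :* (x :- d)) :* (x :- :1)) refl x d ⟩
        (x * (x -F d)) * (x -F 1F)            ≡⟨ cong (_* (x -F 1F)) x[x-d]≡d[x-1] ⟩
        d * (x -F 1F) * (x -F 1F)             ≡⟨ cong (λ z → z * (x -F 1F) * (x -F 1F)) (sym s²≡d) ⟩
        s * s * (x -F 1F) * (x -F 1F)         ≡⟨ solve 2 (λ s x → s :* s :* (x :- :1) :* (x :- :1) := s :* (x :- :1) :* (s :* (x :- :1))) refl s x ⟩
        s * (x -F 1F) * (s * (x -F 1F))       ∎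
      τx≡σx : τ x ≡ σ x
      τx≡σx = fractions-equal (difference≢0 x≢1) x≢0 (trans (solve 2 (λ x d → (x :- d) :* x := x :* (x :- d)) refl x d) x[x-d]≡d[x-1])
      στx≡x : σ (τ x) ≡ x
      στx≡x = trans (cong σ τx≡σx) (σ-involutive x x≢0)

    count-Fixed-στ : count Klein.Fixed-στ? ≡ count FixedEquation-στ?
    count-Fixed-στ = ∑-cong (λ x → 𝟙-⇔ (Klein.Fixed-στ? x) (FixedEquation-στ? x) (Fixed-στ⇒equation x) (equation⇒Fixed-στ x))

    -- The affine map β(x) = d + √(-d)·(x - 1) carries the solutions of the
    -- first equation onto those of the second, since d² - d = (-d)(1 - d).
    count-FixedEquations : count FixedEquation-στ? ≡ count FixedEquation-τ?
    count-FixedEquations = trans (sym (∑ℕ.∑-reindex β β⁻¹ β∘β⁻¹ β⁻¹∘β (λ x → 𝟙[ FixedEquation-στ? x ])))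
                                 (∑-cong (λ x → 𝟙-⇔ (FixedEquation-στ? (β x)) (FixedEquation-τ? x) (fwd x) (bwd x)))
      where
      c : Carrier
      c = i * s
      c² : c * c ≡ (-F 1F) * d
      c² = trans (solve 2 (λ i s → (i :* s) :* (i :* s) := (i :* i) :* (s :* s)) refl i s) (cong₂ _*_ i²≡-1 s²≡d)
      c≢0 : c ≢ 0F
      c≢0 c≡0 = d≢0 (begin
        d                   ≡⟨ solve 1 (λ d → d := :- ((:- :1) :* d)) refl d ⟩
        -F ((-F 1F) * d)    ≡⟨ cong -F_ (sym c²) ⟩
        -F (c * c)          ≡⟨ cong (λ z → -F (z * z)) c≡0 ⟩
        -F (0F * 0F)        ≡⟨ solve 0 (:- (:0 :* :0) := :0) refl ⟩
        0F                  ∎)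
      -d≢0 : (-F 1F) * d ≢ 0F
      -d≢0 = subst (_≢ 0F) c² (square-nonzero c≢0)
      β β⁻¹ : Carrier → Carrier
      β x = d +F c * (x -F 1F)
      β⁻¹ y = 1F +F (y -F d) * inv c
      β∘β⁻¹ : ∀ y → β (β⁻¹ y) ≡ y
      β∘β⁻¹ y = trans (solve 4 (λ d c k y → d :+ c :* ((:1 :+ (y :- d) :* k) :- :1) := d :+ (c :* k) :* (y :- d)) refl d c (inv c) y)
                      (trans (cong (λ z → d +F z * (y -F d)) (x*inv-x c c≢0)) (solve 2 (λ d y → d :+ :1 :* (y :- d) := y) refl d y))
      β⁻¹∘β : ∀ x → β⁻¹ (β x) ≡ x
      β⁻¹∘β x = trans (solve 4 (λ d c k x → :1 :+ ((d :+ c :* (x :- :1)) :- d) :* k := :1 :+ (c :* k) :* (x :- :1)) refl d c (inv c) x)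
                      (trans (cong (λ z → 1F +F z * (x -F 1F)) (x*inv-x c c≢0)) (solve 1 (λ x → :1 :+ :1 :* (x :- :1) := x) refl x))
      lhs : ∀ x → (β x -F d) * (β x -F d) ≡ ((-F 1F) * d) * ((x -F 1F) * (x -F 1F))
      lhs x = trans (solve 3 (λ d c x → ((d :+ c :* (x :- :1)) :- d) :* ((d :+ c :* (x :- :1)) :- d) := (c :* c) :* ((x :- :1) :* (x :- :1))) refl d c x)
                    (cong (_* ((x -F 1F) * (x -F 1F))) c²)
      rhs : (d * d) -F d ≡ ((-F 1F) * d) * (1F -F d)
      rhs = solve 1 (λ d → d :* d :- d := ((:- :1) :* d) :* (:1 :- d)) refl d
      fwd : ∀ x → FixedEquation-στ (β x) → FixedEquation-τ x
      fwd x eq = *-cancelˡ -d≢0 (trans (sym (lhs x)) (trans eq rhs))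
      bwd : ∀ x → FixedEquation-τ x → FixedEquation-στ (β x)
      bwd x eq = trans (lhs x) (trans (cong (((-F 1F) * d) *_) eq) (sym rhs))

    -- The solutions of (x - 1)² = 1 - d come in pairs {x, 2 - x}.
    FixedEquation-τ-even : Σ ℕ λ L → count FixedEquation-τ? ≡ L ℕ.+ L
    FixedEquation-τ-even = count Reflect.Lower? , Reflect.parity-free reflect-free
      where
      reflect : Carrier → Carrier
      reflect x = 2F -F x
      reflect-closed : ∀ x → FixedEquation-τ x → FixedEquation-τ (reflect x)
      reflect-closed x eq = trans (solve 1 (λ x → (((:1 :+ :1) :- x) :- :1) :* (((:1 :+ :1) :- x) :- :1) := (x :- :1) :* (x :- :1)) refl x) eq
      module Reflect = Involution FixedEquation-τ? reflect reflect-closed (λ x _ → solve 1 (λ x → (:1 :+ :1) :- ((:1 :+ :1) :- x) := x) refl x)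
      reflect-free : ∀ x → FixedEquation-τ x → reflect x ≢ x
      reflect-free x eq e with zero-divisor 2F (x -F 1F) (trans (solve 1 (λ x → (:1 :+ :1) :* (x :- :1) := x :- ((:1 :+ :1) :- x)) refl x)
                                                           (trans (cong (λ z → x -F z) e) (solve 1 (λ x → x :- x := :0) refl x)))
      ... | inj₁ 2≡0   = 2≢0 2≡0
      ... | inj₂ x-1≡0 = 1-d≢0 (trans (sym eq) (trans (cong (λ z → z * z) x-1≡0) (0*x 0F)))

    count-X : Σ ℕ λ j → count X? ≡ 2 ℕ.+ 4 ℕ.* j
    count-X = L ℕ.+ k , (begin
      count X?                                      ≡⟨ proj₂ Klein.klein ⟩
      count Klein.Fixed-σ? ℕ.+ (count Klein.Fixed-τ? ℕ.+ (count Klein.Fixed-στ? ℕ.+ ((k ℕ.+ k) ℕ.+ (k ℕ.+ k))))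
        ≡⟨ cong₂ (λ a b → a ℕ.+ (b ℕ.+ (count Klein.Fixed-στ? ℕ.+ ((k ℕ.+ k) ℕ.+ (k ℕ.+ k))))) count-Fixed-σ τ-pairs ⟩
      2 ℕ.+ ((L ℕ.+ L) ℕ.+ (count Klein.Fixed-στ? ℕ.+ ((k ℕ.+ k) ℕ.+ (k ℕ.+ k))))
        ≡⟨ cong (λ b → 2 ℕ.+ ((L ℕ.+ L) ℕ.+ (b ℕ.+ ((k ℕ.+ k) ℕ.+ (k ℕ.+ k))))) (trans count-Fixed-στ (trans count-FixedEquations (proj₂ FixedEquation-τ-even))) ⟩
      2 ℕ.+ ((L ℕ.+ L) ℕ.+ ((L ℕ.+ L) ℕ.+ ((k ℕ.+ k) ℕ.+ (k ℕ.+ k))))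
        ≡⟨ regroup L k ⟩
      2 ℕ.+ 4 ℕ.* (L ℕ.+ k)                         ∎)
      where
      k = proj₁ Klein.klein
      L = proj₁ FixedEquation-τ-even
      τ-pairs : count Klein.Fixed-τ? ≡ L ℕ.+ L
      τ-pairs = trans count-Fixed-τ (proj₂ FixedEquation-τ-even)
      regroup : ∀ L k → 2 ℕ.+ ((L ℕ.+ L) ℕ.+ ((L ℕ.+ L) ℕ.+ ((k ℕ.+ k) ℕ.+ (k ℕ.+ k)))) ≡ 2 ℕ.+ 4 ℕ.* (L ℕ.+ k)
      regroup = solve-∀

    count-f-roots : count (λ x → f x ≟ 0F) ≡ 3
    count-f-roots = begin
      count (λ x → f x ≟ 0F)                         ≡⟨ ∑-cong split ⟩
      ∑ (λ x → 𝟙[ x ≟ 0F ] ℕ.+ (𝟙[ x ≟ 1F ] ℕ.+ 𝟙[ x ≟ d ]))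
        ≡⟨ ∑-+ (λ x → 𝟙[ x ≟ 0F ]) (λ x → 𝟙[ x ≟ 1F ] ℕ.+ 𝟙[ x ≟ d ]) ⟩
      count (_≟ 0F) ℕ.+ ∑ (λ x → 𝟙[ x ≟ 1F ] ℕ.+ 𝟙[ x ≟ d ])
        ≡⟨ cong (count (_≟ 0F) ℕ.+_) (∑-+ (λ x → 𝟙[ x ≟ 1F ]) (λ x → 𝟙[ x ≟ d ])) ⟩
      count (_≟ 0F) ℕ.+ (count (_≟ 1F) ℕ.+ count (_≟ d))
        ≡⟨ cong₂ ℕ._+_ (count-≡ 0F) (cong₂ ℕ._+_ (count-≡ 1F) (count-≡ d)) ⟩
      3                                              ∎
      where
      split : ∀ x → 𝟙[ f x ≟ 0F ] ≡ 𝟙[ x ≟ 0F ] ℕ.+ (𝟙[ x ≟ 1F ] ℕ.+ 𝟙[ x ≟ d ])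
      split x = trans (𝟙-⇔ (f x ≟ 0F) ((x ≟ 0F) ⊎-dec ((x ≟ 1F) ⊎-dec (x ≟ d))) f-roots f-root)
                      (trans (𝟙-⊎ (x ≟ 0F) ((x ≟ 1F) ⊎-dec (x ≟ d)) disjoint₁)
                             (cong (𝟙[ x ≟ 0F ] ℕ.+_) (𝟙-⊎ (x ≟ 1F) (x ≟ d) disjoint₂)))
        where
        disjoint₁ : ¬ (x ≡ 0F × (x ≡ 1F ⊎ x ≡ d))
        disjoint₁ (x≡0 , inj₁ x≡1) = 0≢1 (trans (sym x≡0) x≡1)
        disjoint₁ (x≡0 , inj₂ x≡d) = d≢0 (trans (sym x≡d) x≡0)
        disjoint₂ : ¬ (x ≡ 1F × x ≡ d)
        disjoint₂ (x≡1 , x≡d) = d≢1 (trans (sym x≡d) x≡1)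

    -- 1 + χ₂(v) is the number of square roots of v.
    1+χ₂ : ∀ v → + 1 ℤ.+ χ₂ v ≡ + (𝟙[ v ≟ 0F ] ℕ.+ (𝟙[ NonzeroSquare? v ] ℕ.+ 𝟙[ NonzeroSquare? v ]))
    1+χ₂ v = by-cases (v ≟ 0F) (isSquare? v)
      where
      by-cases : Dec (v ≡ 0F) → Dec (IsSquare v) → + 1 ℤ.+ χ₂ v ≡ + (𝟙[ v ≟ 0F ] ℕ.+ (𝟙[ NonzeroSquare? v ] ℕ.+ 𝟙[ NonzeroSquare? v ]))
      by-cases (yes v≡0) _ = trans (cong (ℤ._+_ (+ 1)) (χ₂-zero v v≡0))
        (cong +_ (sym (cong₂ (λ a b → a ℕ.+ (b ℕ.+ b)) (𝟙-yes (v ≟ 0F) v≡0) (𝟙-no (NonzeroSquare? v) (λ (v≢0 , _) → v≢0 v≡0)))))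
      by-cases (no v≢0) (yes sv) = trans (cong (ℤ._+_ (+ 1)) (χ₂-square v v≢0 sv))
        (cong +_ (sym (cong₂ (λ a b → a ℕ.+ (b ℕ.+ b)) (𝟙-no (v ≟ 0F) v≢0) (𝟙-yes (NonzeroSquare? v) (v≢0 , sv)))))
      by-cases (no v≢0) (no ¬sv) = trans (cong (ℤ._+_ (+ 1)) (χ₂-nonsquare v ¬sv))
        (cong +_ (sym (cong₂ (λ a b → a ℕ.+ (b ℕ.+ b)) (𝟙-no (v ≟ 0F) v≢0) (𝟙-no (NonzeroSquare? v) (¬sv ∘ proj₂)))))

    q+∑χ₂ : + q ℤ.+ ∑ℤ.∑ (χ₂ ∘ f) ≡ + (3 ℕ.+ (count X? ℕ.+ count X?))
    q+∑χ₂ = begin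
      + q ℤ.+ ∑ℤ.∑ (χ₂ ∘ f)                    ≡⟨ cong (λ n → + n ℤ.+ ∑ℤ.∑ (χ₂ ∘ f)) (sym ∑-ones) ⟩
      + ∑ (λ _ → 1) ℤ.+ ∑ℤ.∑ (χ₂ ∘ f)          ≡⟨ cong (ℤ._+ ∑ℤ.∑ (χ₂ ∘ f)) (sym (∑ℤ-pos (λ _ → 1))) ⟩
      ∑ℤ.∑ (λ _ → + 1) ℤ.+ ∑ℤ.∑ (χ₂ ∘ f)       ≡⟨ sym (∑ℤ.∑-+ (λ _ → + 1) (χ₂ ∘ f)) ⟩
      ∑ℤ.∑ (λ x → + 1 ℤ.+ χ₂ (f x))            ≡⟨ ∑ℤ.∑-cong (1+χ₂ ∘ f) ⟩
      ∑ℤ.∑ (λ x → + roots x)                   ≡⟨ ∑ℤ-pos roots ⟩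
      + ∑ roots                                ≡⟨ cong +_ (trans (∑-+ (λ x → 𝟙[ f x ≟ 0F ]) (λ x → 𝟙[ X? x ] ℕ.+ 𝟙[ X? x ]))
                                                    (cong₂ ℕ._+_ count-f-roots (∑-+ (λ x → 𝟙[ X? x ]) (λ x → 𝟙[ X? x ])))) ⟩
      + (3 ℕ.+ (count X? ℕ.+ count X?))        ∎
      where
      roots : Carrier → ℕ
      roots x = 𝟙[ f x ≟ 0F ] ℕ.+ (𝟙[ X? x ] ℕ.+ 𝟙[ X? x ])

    -- #L_d(F_q) = q + 1 - A(d) = 4 + 2|X| is divisible by 8.
    8∣points : (+ 8) ∣ (+ suc q - traceA d)
    8∣points = subst ((+ 8) ∣_) (sym points≡8[j+1]) (ND.n∣m*n (suc j))
      where
      j = proj₁ count-X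
      points≡8[j+1] : + suc q - traceA d ≡ + (suc j ℕ.* 8)
      points≡8[j+1] = begin
        + suc q - traceA d                          ≡⟨ cong (λ a → + suc q ℤ.+ - a) (traceA≡∑ d) ⟩
        + suc q ℤ.+ - (- ∑ℤ.∑ (χ₂ ∘ f))             ≡⟨ cong (ℤ._+_ (+ suc q)) (ℤP.neg-involutive (∑ℤ.∑ (χ₂ ∘ f))) ⟩
        (+ 1 ℤ.+ + q) ℤ.+ ∑ℤ.∑ (χ₂ ∘ f)             ≡⟨ ℤP.+-assoc (+ 1) (+ q) (∑ℤ.∑ (χ₂ ∘ f)) ⟩
        + 1 ℤ.+ (+ q ℤ.+ ∑ℤ.∑ (χ₂ ∘ f))             ≡⟨ cong (ℤ._+_ (+ 1)) q+∑χ₂ ⟩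
        + 1 ℤ.+ + (3 ℕ.+ (count X? ℕ.+ count X?))   ≡⟨ cong (λ n → + (suc (3 ℕ.+ (n ℕ.+ n)))) (proj₂ count-X) ⟩
        + (4 ℕ.+ ((2 ℕ.+ 4 ℕ.* j) ℕ.+ (2 ℕ.+ 4 ℕ.* j))) ≡⟨ cong +_ (arithmetic j) ⟩
        + (suc j ℕ.* 8)                             ∎
        where
        arithmetic : ∀ j → 4 ℕ.+ ((2 ℕ.+ 4 ℕ.* j) ℕ.+ (2 ℕ.+ 4 ℕ.* j)) ≡ suc j ℕ.* 8
        arithmetic = solve-∀

  -- If q = 4t + 1 and 8 ∣ q + 1 - A, then no square d has A(d) = -A, since
  -- 8 ∣ q + 1 - A(d) for those; hence N(-A) only counts nonsquares.
  Nn2≡N : ∀ t → q ≡ suc ((t ℕ.+ t) ℕ.+ (t ℕ.+ t)) → ∀ A → (+ 8) ∣ (+ suc q - A) → Nn2 (- A) ≡ N (- A)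
  Nn2≡N t q≡4t+1 A 8∣q+1-A = begin
    Nn2 (- A)                                            ≡⟨ count-filter (λ d → Counted? (- A) d ×-dec ¬? (isSquare? d)) ⟩
    count (λ d → Counted? (- A) d ×-dec ¬? (isSquare? d))
      ≡⟨ ∑-cong (λ d → 𝟙-⇔ (Counted? (- A) d ×-dec ¬? (isSquare? d)) (Counted? (- A) d) proj₁ (λ c → c , nonsquare c)) ⟩
    count (Counted? (- A))                               ≡⟨ sym (count-filter (Counted? (- A))) ⟩
    N (- A)                                              ∎
    where
    nonsquare : ∀ {d} → d ≢ 0F × d ≢ 1F × traceA d ≡ - A → ¬ IsSquare d
    nonsquare {d} (d≢0 , d≢1 , trace≡-A) square-d = not-both-divisible-by-8 q t A q≡4t+1 8∣q+1-A
      (subst (λ a → (+ 8) ∣ (+ suc q - a)) trace≡-A (SquareParameter.8∣points t q≡4t+1 d d≢0 d≢1 square-d))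

theorem6p6 : (q : ℕ) → IsPrimePower q → q % 4 ≡ 1 → (F : FiniteField q) →
    (A : ℤ) → (+ 8) ∣ (+ suc q - A) →
    FiniteField.Nn2 F A ≡ FiniteField.Nn2 F (- A) × FiniteField.Nn2 F (- A) ≡ FiniteField.N F (- A)
theorem6p6 q _ q%4≡1 F A 8∣q+1-A =
  TraceInversion.Nn2-symmetric F (t ℕ.+ t) q≡4t+1 A , Nn2≡N F t q≡4t+1 A 8∣q+1-A
  where
  t = q ℕ./ 4
  q≡4t+1 = %4≡1⇒4t+1 q q%4≡1
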